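{- For $n\ge 1$, $$|\mathrm{Modasc}_n(1232)|=\sum_{k=1}^n\binom{n-1}{k-1}\sum_{j=1}^k(j-1)!\,S(k-j+1,j).$$ Furthermore, $$\sum_{n\ge0}|\mathrm{Modasc}_n(1232)|\,t^n=\sum_{i\ge 0}\frac{t^i(1-t)}{1-(i+1)t}.$$
   Context: A Cayley permutation of length $n$ is a word $x=x_1\cdots x_n$ of positive integers whose set of values is $\{1,\dots,k\}$ for some $k\le n$ (the empty word is the unique one of length $0$). A Cayley permutation $x$ contains $y=y_1\cdots y_k$ if there are indices $i_1<\cdots<i_k$ with $x_{i_s}<x_{i_t}\iff y_s<y_t$ and $x_{i_s}=x_{i_t}\iff y_s=y_t$ for all $s,t$; otherwise $x$ avoids $y$. The ascent tops of $x$ are the pairs $(1,x_1)$ and $(i,x_i)$ with $1<i\le n$ and $x_{i-1}<x_i$; the leftmost copies are the pairs $(\min\{i:x_i=j\},j)$ for $1\le j\le\max(x)$. A modified ascent sequence is a Cayley permutation whose set of ascent tops equals its set of leftmost copies. $\mathrm{Modasc}_n(y)$ is the set of modified ascent sequences of length $n$ avoiding $y$. $S(m,k)$ is the Stirling number of the second kind. -}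

module Defs where

open import Data.Nat using (ℕ; zero; suc; _!; _+_; _*_; _∸_; _^_; _≤_; _<_; _⊔_)
open import Data.Nat.Combinatorics using (_C_)
open import Data.Integer as ℤ using (ℤ; +_)
open import Data.Fin using (Fin; toℕ)
open import Data.List using (List; []; _∷_; length; lookup; applyUpTo; foldr; map)
open import Data.Nat.ListAction using (sum)
open import Data.List.Membership.Propositional using (_∈_)
open import Data.List.Relation.Unary.Unique.Propositional using (Unique)
open import Data.Product using (Σ; _×_; _,_)
open import Data.Sum using (_⊎_)
open import Relation.Binary.PropositionalEquality using (_≡_; _≢_)
open import Relation.Nullary using (¬_)
open import Function.Bundles using (_⇔_)

Σ₁ : ℕ → (ℕ → ℕ) → ℕ
Σ₁ n f = sum (applyUpTo (λ i → f (suc i)) n)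

Σℤ₀ : ℕ → (ℕ → ℤ) → ℤ
Σℤ₀ n f = foldr ℤ._+_ (+ 0) (applyUpTo f (suc n))

S : ℕ → ℕ → ℕ
S zero    zero    = 1
S zero    (suc k) = 0
S (suc m) zero    = 0
S (suc m) (suc k) = suc k * S m (suc k) + S m k

-- Words (Cayley permutations), 0-indexed positions internally

Word : Set
Word = List ℕ

maxW : Word → ℕ
maxW = foldr _⊔_ 0

IsCayley : Word → Set
IsCayley x = (∀ v → v ∈ x → 1 ≤ v) × (∀ j → 1 ≤ j → j ≤ maxW x → j ∈ x)

Contains : Word → Word → Set
Contains x y =
  Σ (Fin (length y) → Fin (length x)) λ f →
    (∀ s t → toℕ s < toℕ t → toℕ (f s) < toℕ (f t)) ×
    (∀ s t → ((lookup x (f s) < lookup x (f t)) ⇔ (lookup y s < lookup y t))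
           × ((lookup x (f s) ≡ lookup x (f t)) ⇔ (lookup y s ≡ lookup y t)))

Avoids : Word → Word → Set
Avoids x y = ¬ Contains x y

AscentTop : (x : Word) → Fin (length x) → ℕ → Set
AscentTop x i v =
  lookup x i ≡ v ×
  (toℕ i ≡ 0 ⊎ Σ (Fin (length x)) λ j → suc (toℕ j) ≡ toℕ i × lookup x j < lookup x i)

LeftmostCopy : (x : Word) → Fin (length x) → ℕ → Set
LeftmostCopy x i v =
  1 ≤ v × v ≤ maxW x × lookup x i ≡ v ×
  (∀ j → toℕ j < toℕ i → lookup x j ≢ v)

IsModAsc : Word → Set
IsModAsc x = IsCayley x × (∀ i v → AscentTop x i v ⇔ LeftmostCopy x i v)

Modasc : ℕ → Word → Word → Set
Modasc n y x = length x ≡ n × IsModAsc x × Avoids x y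

HasCard : (Word → Set) → ℕ → Set
HasCard P m = Σ (List Word) λ L → Unique L × (∀ x → x ∈ L ⇔ P x) × length L ≡ m

formula : ℕ → ℕ
formula n = Σ₁ n λ k → ((n ∸ 1) C (k ∸ 1)) * Σ₁ k (λ j → ((j ∸ 1) !) * S (k ∸ j + 1) j)

FPS : Set
FPS = ℕ → ℤ

_·_ : FPS → FPS → FPS
(f · g) n = Σℤ₀ n λ k → f k ℤ.* g (n ∸ k)

tPow : ℕ → FPS
tPow i n with i Data.Nat.≟ n
... | Relation.Nullary.yes _ = + 1
... | Relation.Nullary.no  _ = + 0

oneMinusT : FPS
oneMinusT zero          = + 1
oneMinusT (suc zero)    = ℤ.- (+ 1)
oneMinusT (suc (suc _)) = + 0

-- 1 / (1 - a t) = Σ_n a^n t^n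
geomInv : ℕ → FPS
geomInv a n = + (a ^ n)

gfTerm : ℕ → FPS
gfTerm i = tPow i · (oneMinusT · geomInv (suc i))

-- Σ_{i≥0} gfTerm i ; well-defined since gfTerm i has order ≥ i, so the
-- coefficient of t^n only receives contributions from i ≤ n.
gfSum : FPS
gfSum n = Σℤ₀ n λ i → gfTerm i n

module Submission where

-- In a modified ascent sequence avoiding 1232, every letter after the first is 1, a repeat of its
-- predecessor c, or a new letter exceeding c. Indeed, a letter b ∉ {1, c} that occurred earlier is
-- not an ascent top (ascent tops are leftmost copies), so c > b and 1 b c b occurs; and a new letter
-- is a leftmost copy, hence an ascent top. So these words are exactly 1 followed by a tail in which
-- every letter is 1 or at least its predecessor and the copies of each letter ≥ 2 are consecutive.
-- Deleting one copy of the maximum of a tail with a ones and r + 1 larger letters leaves a tail with r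
-- larger letters, from which it is recovered by duplicating the maximum (possible iff r > 0) or by
-- inserting a new maximum just before one of the a ones or at the end. Hence there are c(a, r) such
-- tails, where c(a, 0) = 1 and c(a, r) = (a+1)(a+2)^(r−1), and |Modasc_n(1232)| = Σ_a c(a, n−1−a) is the
-- coefficient of t^n in Σ_i t^i(1−t)/(1−(i+1)t). The Stirling sum reduces to the same count by
-- Chu–Vandermonde and Σ_j C(a,j) j! S(q+1,j+1) = (a+1)^q.

open import Data.Nat
open import Data.Nat.Properties
open import Data.Nat.Combinatorics using (_C_; k>n⇒nCk≡0; nCk+nC[k+1]≡[n+1]C[k+1]; nCk≡nC[n∸k]; nCn≡1)
open import Data.Nat.ListAction using (sum)
open import Data.Nat.Tactic.RingSolver using (solve-∀)
open import Data.Integer as ℤ using (ℤ)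
import Data.Integer.Properties as ℤ
open import Data.Fin as F using (Fin; toℕ; fromℕ<)
open import Data.Fin.Properties using (toℕ-fromℕ<; toℕ<n; ¬Fin0)
open import Data.List using (List; []; _∷_; applyUpTo; foldr; length; lookup; replicate; map; concatMap; upTo)
open import Data.List.Properties using (length-++; length-applyUpTo; length-map; map-upTo; ∷-injectiveʳ)
open import Data.List.Membership.Propositional using (_∈_; _∉_; find; lose)
open import Data.List.Membership.Propositional.Properties
  using (∈-concatMap⁺; ∈-concatMap⁻; ∈-applyUpTo⁻; ∈-applyUpTo⁺; ∈-map⁻; ∈-map⁺; ∈-upTo⁺; ∈-upTo⁻)
open import Data.List.Membership.DecPropositional _≟_ using (_∈?_)
open import Data.List.Relation.Unary.Any using (here; there)
import Data.List.Relation.Unary.All as All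
open import Data.List.Relation.Unary.AllPairs using ([]; _∷_)
open import Data.List.Relation.Unary.Unique.Propositional using (Unique)
import Data.List.Relation.Unary.Unique.Propositional.Properties as UP
open import Data.Product using (Σ; _×_; _,_; proj₁; proj₂)
open import Data.Sum using (_⊎_; inj₁; inj₂)
open import Data.Empty using (⊥-elim)
open import Data.Unit using (⊤; tt)
open import Function using (_∘_)
open import Function.Bundles using (_⇔_; mk⇔; Equivalence)
open import Relation.Nullary using (¬_; yes; no; Dec)
open import Relation.Binary.Definitions using (tri<; tri≈; tri>)
open import Relation.Binary.PropositionalEquality
open ≡-Reasoning

open import Defs

Σ< : ℕ → (ℕ → ℕ) → ℕ
Σ< n f = sum (applyUpTo f n)

Σ<-cong : ∀ n {f g : ℕ → ℕ} → (∀ i → i < n → f i ≡ g i) → Σ< n f ≡ Σ< n g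
Σ<-cong zero    eq = refl
Σ<-cong (suc n) eq = cong₂ _+_ (eq 0 z<s) (Σ<-cong n (λ i i<n → eq (suc i) (s<s i<n)))

Σ<-zero : ∀ n f → (∀ i → i < n → f i ≡ 0) → Σ< n f ≡ 0
Σ<-zero zero    f eq = refl
Σ<-zero (suc n) f eq = cong₂ _+_ (eq 0 z<s) (Σ<-zero n (f ∘ suc) (λ i i<n → eq (suc i) (s<s i<n)))

Σ<-suc : ∀ n f → Σ< (suc n) f ≡ Σ< n f + f n
Σ<-suc zero    f = +-identityʳ (f 0)
Σ<-suc (suc n) f = begin
  f 0 + Σ< (suc n) (f ∘ suc)         ≡⟨ cong (f 0 +_) (Σ<-suc n (f ∘ suc)) ⟩
  f 0 + (Σ< n (f ∘ suc) + f (suc n)) ≡⟨ +-assoc (f 0) _ _ ⟨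
  f 0 + Σ< n (f ∘ suc) + f (suc n)   ∎

Σ<-+ : ∀ n f g → Σ< n (λ i → f i + g i) ≡ Σ< n f + Σ< n g
Σ<-+ zero    f g = refl
Σ<-+ (suc n) f g = trans (cong (f 0 + g 0 +_) (Σ<-+ n (f ∘ suc) (g ∘ suc)))
                         (interchange (f 0) (g 0) (Σ< n (f ∘ suc)) (Σ< n (g ∘ suc)))
  where
  interchange : ∀ a b c d → (a + b) + (c + d) ≡ (a + c) + (b + d)
  interchange = solve-∀

Σ<-*ˡ : ∀ n c f → Σ< n (λ i → c * f i) ≡ c * Σ< n f
Σ<-*ˡ zero    c f = sym (*-zeroʳ c)
Σ<-*ˡ (suc n) c f = trans (cong (c * f 0 +_) (Σ<-*ˡ n c (f ∘ suc))) (sym (*-distribˡ-+ c (f 0) _))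

Σ<-*ʳ : ∀ n c f → Σ< n (λ i → f i * c) ≡ Σ< n f * c
Σ<-*ʳ n c f = begin
  Σ< n (λ i → f i * c) ≡⟨ Σ<-cong n (λ i _ → *-comm (f i) c) ⟩
  Σ< n (λ i → c * f i) ≡⟨ Σ<-*ˡ n c f ⟩
  c * Σ< n f           ≡⟨ *-comm c _ ⟩
  Σ< n f * c           ∎

Σ<-comm : ∀ m n (f : ℕ → ℕ → ℕ) → Σ< m (λ i → Σ< n (f i)) ≡ Σ< n (λ j → Σ< m (λ i → f i j))
Σ<-comm zero    n f = sym (Σ<-zero n (λ _ → 0) (λ _ _ → refl))
Σ<-comm (suc m) n f = begin
  Σ< n (f 0) + Σ< m (λ i → Σ< n (f (suc i)))       ≡⟨ cong (Σ< n (f 0) +_) (Σ<-comm m n (f ∘ suc)) ⟩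
  Σ< n (f 0) + Σ< n (λ j → Σ< m (λ i → f (suc i) j)) ≡⟨ Σ<-+ n (f 0) _ ⟨
  Σ< n (λ j → Σ< (suc m) (λ i → f i j))              ∎

Σ<-++ : ∀ m n f → Σ< (m + n) f ≡ Σ< m f + Σ< n (λ i → f (m + i))
Σ<-++ zero    n f = refl
Σ<-++ (suc m) n f = trans (cong (f 0 +_) (Σ<-++ m n (f ∘ suc))) (sym (+-assoc (f 0) _ _))

Σ<-vanishing-tail : ∀ m n f → m ≤ n → (∀ i → m ≤ i → i < n → f i ≡ 0) → Σ< n f ≡ Σ< m f
Σ<-vanishing-tail m n f m≤n tail≡0 = begin
  Σ< n f                                  ≡⟨ cong (λ k → Σ< k f) (m+[n∸m]≡n m≤n) ⟨
  Σ< (m + (n ∸ m)) f                      ≡⟨ Σ<-++ m (n ∸ m) f ⟩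
  Σ< m f + Σ< (n ∸ m) (λ i → f (m + i)) ≡⟨ cong (Σ< m f +_) (Σ<-zero (n ∸ m) _ tail-term≡0) ⟩
  Σ< m f + 0                              ≡⟨ +-identityʳ _ ⟩
  Σ< m f                                  ∎
  where
  tail-term≡0 : ∀ i → i < n ∸ m → f (m + i) ≡ 0
  tail-term≡0 i i< = tail≡0 (m + i) (m≤m+n m i) (subst (m + i <_) (m+[n∸m]≡n m≤n) (+-monoʳ-< m i<))

m∸n≡suc[m∸suc[n]] : ∀ {m n} → n < m → m ∸ n ≡ suc (m ∸ suc n)
m∸n≡suc[m∸suc[n]] {suc m} (s≤s n≤m) = +-∸-assoc 1 n≤m

Σ<-triangle : ∀ n (h : ℕ → ℕ → ℕ) →
              Σ< n (λ k → Σ< (suc k) (λ j → h j (k ∸ j))) ≡ Σ< n (λ j → Σ< (n ∸ j) (h j))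
Σ<-triangle zero    h = refl
Σ<-triangle (suc n) h = begin
  Σ< (suc n) (λ k → Σ< (suc k) (λ j → h j (k ∸ j)))
    ≡⟨ Σ<-suc n _ ⟩
  Σ< n (λ k → Σ< (suc k) (λ j → h j (k ∸ j))) + Σ< (suc n) (λ j → h j (n ∸ j))
    ≡⟨ cong (_+ Σ< (suc n) (λ j → h j (n ∸ j))) (trans (Σ<-triangle n h) (sym last-row-empty)) ⟩
  Σ< (suc n) (λ j → Σ< (n ∸ j) (h j)) + Σ< (suc n) (λ j → h j (n ∸ j))
    ≡⟨ Σ<-+ (suc n) (λ j → Σ< (n ∸ j) (h j)) (λ j → h j (n ∸ j)) ⟨
  Σ< (suc n) (λ j → Σ< (n ∸ j) (h j) + h j (n ∸ j))
    ≡⟨ Σ<-cong (suc n) (λ j j< → trans (sym (Σ<-suc (n ∸ j) (h j))) (cong (λ k → Σ< k (h j)) (sym (m∸n≡suc[m∸suc[n]] j<)))) ⟩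
  Σ< (suc n) (λ j → Σ< (suc n ∸ j) (h j)) ∎
  where
  last-row-empty : Σ< (suc n) (λ j → Σ< (n ∸ j) (h j)) ≡ Σ< n (λ j → Σ< (n ∸ j) (h j))
  last-row-empty = begin
    Σ< (suc n) (λ j → Σ< (n ∸ j) (h j))                 ≡⟨ Σ<-suc n _ ⟩
    Σ< n (λ j → Σ< (n ∸ j) (h j)) + Σ< (n ∸ n) (h n)    ≡⟨ cong (λ k → Σ< n (λ j → Σ< (n ∸ j) (h j)) + Σ< k (h n)) (n∸n≡0 n) ⟩
    Σ< n (λ j → Σ< (n ∸ j) (h j)) + 0                   ≡⟨ +-identityʳ _ ⟩
    Σ< n (λ j → Σ< (n ∸ j) (h j))                       ∎

module _ {A B : Set} where

  Unique-concatMap : ∀ (f : A → List B) (key : B → A) L → Unique L → (∀ y → y ∈ L → Unique (f y)) →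
                     (∀ y x → y ∈ L → x ∈ f y → key x ≡ y) → Unique (concatMap f L)
  Unique-concatMap f key [] _ _ _ = []
  Unique-concatMap f key (y ∷ ys) (y∉ ∷ u) unique-f key-inverse =
    UP.++⁺ (unique-f y (here refl))
           (Unique-concatMap f key ys u (λ y′ p → unique-f y′ (there p)) (λ y′ x p q → key-inverse y′ x (there p) q))
           disjoint
    where
    disjoint : ∀ {v} → ¬ (v ∈ f y × v ∈ concatMap f ys)
    disjoint {v} (p , q) with find (∈-concatMap⁻ f q)
    ... | y′ , y′∈ , q′ = All.lookup y∉ y′∈ (trans (sym (key-inverse y v (here refl) p)) (key-inverse y′ v (there y′∈) q′))

  length-concatMap : ∀ (f : A → List B) L → length (concatMap f L) ≡ sum (map (λ y → length (f y)) L)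
  length-concatMap f [] = refl
  length-concatMap f (y ∷ ys) = trans (length-++ (f y)) (cong (length (f y) +_) (length-concatMap f ys))

  length-concatMap-const : ∀ (f : A → List B) L c → (∀ y → y ∈ L → length (f y) ≡ c) →
                           length (concatMap f L) ≡ length L * c
  length-concatMap-const f [] c h = refl
  length-concatMap-const f (y ∷ ys) c h =
    trans (length-++ (f y)) (cong₂ _+_ (h y (here refl)) (length-concatMap-const f ys c (λ y′ p → h y′ (there p))))

choose : ℕ → ℕ → ℕ
choose zero    zero    = 1
choose zero    (suc k) = 0
choose (suc n) zero    = 1
choose (suc n) (suc k) = choose n k + choose n (suc k)

choose-zero : ∀ n → choose n 0 ≡ 1
choose-zero zero    = refl
choose-zero (suc n) = refl

choose-one : ∀ n → choose n 1 ≡ n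
choose-one zero    = refl
choose-one (suc n) = cong₂ _+_ (choose-zero n) (choose-one n)

choose-vanish : ∀ n k → n < k → choose n k ≡ 0
choose-vanish zero    (suc k) _         = refl
choose-vanish (suc n) (suc k) (s<s n<k) = cong₂ _+_ (choose-vanish n k n<k) (choose-vanish n (suc k) (m<n⇒m<1+n n<k))

choose≡C : ∀ n k → choose n k ≡ n C k
choose≡C zero    zero    = refl
choose≡C zero    (suc k) = sym (k>n⇒nCk≡0 {0} {suc k} z<s)
choose≡C (suc n) zero    = sym (trans (nCk≡nC[n∸k] {0} {suc n} z≤n) (nCn≡1 (suc n)))
choose≡C (suc n) (suc k) = trans (cong₂ _+_ (choose≡C n k) (choose≡C n (suc k))) (nCk+nC[k+1]≡[n+1]C[k+1] n k)

choose-absorb : ∀ n k → suc k * choose (suc n) (suc k) ≡ suc n * choose n k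
choose-absorb zero    zero    = refl
choose-absorb zero    (suc k) = trans (*-zeroʳ (2 + k)) (sym (*-zeroʳ 1))
choose-absorb (suc n) zero    = trans (*-identityˡ _) (trans (cong suc (choose-one (suc n))) (sym (*-identityʳ _)))
choose-absorb (suc n) (suc k) = begin
  (2 + k) * (x + y)             ≡⟨ expand k x y ⟩
  (1 + k) * x + x + (2 + k) * y ≡⟨ cong₂ (λ p q → p + x + q) (choose-absorb n k) (choose-absorb n (suc k)) ⟩
  (1 + n) * u + x + (1 + n) * v ≡⟨ collect n u x v ⟩
  (1 + n) * (u + v) + x         ≡⟨⟩
  (1 + n) * x + x               ≡⟨ +-comm ((1 + n) * x) x ⟩
  (2 + n) * x                   ∎
  where
  x = choose (suc n) (suc k)
  y = choose (suc n) (2 + k)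
  u = choose n k
  v = choose n (suc k)
  expand : ∀ k x y → (2 + k) * (x + y) ≡ (1 + k) * x + x + (2 + k) * y
  expand = solve-∀
  collect : ∀ n u x v → (1 + n) * u + x + (1 + n) * v ≡ (1 + n) * (u + v) + x
  collect = solve-∀

hockey-stick : ∀ n j → Σ< (suc n) (λ a → choose a j) ≡ choose (suc n) (suc j)
hockey-stick zero    j = refl
hockey-stick (suc n) j = begin
  Σ< (suc (suc n)) (λ a → choose a j)           ≡⟨ Σ<-suc (suc n) (λ a → choose a j) ⟩
  Σ< (suc n) (λ a → choose a j) + choose (suc n) j ≡⟨ cong (_+ choose (suc n) j) (hockey-stick n j) ⟩
  choose (suc n) (suc j) + choose (suc n) j       ≡⟨ +-comm (choose (suc n) (suc j)) _ ⟩
  choose (suc (suc n)) (suc j)                    ∎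

vandermonde : ∀ n j q → Σ< (suc n) (λ a → choose a j * choose (n ∸ a) q) ≡ choose (suc n) (suc (j + q))
vandermonde zero    zero    zero    = refl
vandermonde zero    zero    (suc q) = refl
vandermonde zero    (suc j) q       = refl
vandermonde (suc n) j       zero    = begin
  Σ< (2 + n) (λ a → choose a j * choose (suc n ∸ a) 0)
    ≡⟨ Σ<-cong (2 + n) (λ a _ → trans (cong (choose a j *_) (choose-zero (suc n ∸ a))) (*-identityʳ (choose a j))) ⟩
  Σ< (2 + n) (λ a → choose a j) ≡⟨ hockey-stick (suc n) j ⟩
  choose (2 + n) (suc j)        ≡⟨ cong (λ i → choose (2 + n) (suc i)) (+-identityʳ j) ⟨
  choose (2 + n) (suc (j + 0))  ∎
vandermonde (suc n) j (suc q) = begin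
  Σ< (2 + n) (λ a → choose a j * choose (suc n ∸ a) (suc q))
    ≡⟨ Σ<-suc (suc n) (λ a → choose a j * choose (suc n ∸ a) (suc q)) ⟩
  Σ< (suc n) (λ a → choose a j * choose (suc n ∸ a) (suc q)) + choose (suc n) j * choose (suc n ∸ suc n) (suc q)
    ≡⟨ cong₂ _+_ (Σ<-cong (suc n) pascal) (trans (cong (λ i → choose (suc n) j * choose i (suc q)) (n∸n≡0 n)) (*-zeroʳ (choose (suc n) j))) ⟩
  Σ< (suc n) (λ a → choose a j * choose (n ∸ a) q + choose a j * choose (n ∸ a) (suc q)) + 0
    ≡⟨ +-identityʳ _ ⟩
  Σ< (suc n) (λ a → choose a j * choose (n ∸ a) q + choose a j * choose (n ∸ a) (suc q))
    ≡⟨ Σ<-+ (suc n) (λ a → choose a j * choose (n ∸ a) q) (λ a → choose a j * choose (n ∸ a) (suc q)) ⟩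
  Σ< (suc n) (λ a → choose a j * choose (n ∸ a) q) + Σ< (suc n) (λ a → choose a j * choose (n ∸ a) (suc q))
    ≡⟨ cong₂ _+_ (vandermonde n j q) (vandermonde n j (suc q)) ⟩
  choose (suc n) (suc (j + q)) + choose (suc n) (suc (j + suc q))
    ≡⟨ cong (λ i → choose (suc n) i + choose (suc n) (suc (j + suc q))) (+-suc j q) ⟨
  choose (2 + n) (suc (j + suc q)) ∎
  where
  pascal : ∀ a → a < suc n → choose a j * choose (suc n ∸ a) (suc q)
                           ≡ choose a j * choose (n ∸ a) q + choose a j * choose (n ∸ a) (suc q)
  pascal a a< = trans (cong (λ i → choose a j * choose i (suc q)) (m∸n≡suc[m∸suc[n]] a<)) (*-distribˡ-+ (choose a j) _ _)

choosePred : ℕ → ℕ → ℕ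
choosePred zero    zero    = 1
choosePred zero    (suc q) = 0
choosePred (suc r) zero    = 0
choosePred (suc r) (suc q) = choose r q

vandermonde′ : ∀ n j q → Σ< (suc n) (λ a → choose a j * choosePred (n ∸ a) q) ≡ choose n (j + q)
vandermonde′ n j zero = begin
  Σ< (suc n) (λ a → choose a j * choosePred (n ∸ a) 0)
    ≡⟨ Σ<-suc n (λ a → choose a j * choosePred (n ∸ a) 0) ⟩
  Σ< n (λ a → choose a j * choosePred (n ∸ a) 0) + choose n j * choosePred (n ∸ n) 0
    ≡⟨ cong₂ _+_ (Σ<-zero n _ early≡0) (trans (cong (λ i → choose n j * choosePred i 0) (n∸n≡0 n)) (*-identityʳ _)) ⟩
  choose n j       ≡⟨ cong (choose n) (+-identityʳ j) ⟨
  choose n (j + 0) ∎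
  where
  early≡0 : ∀ a → a < n → choose a j * choosePred (n ∸ a) 0 ≡ 0
  early≡0 a a<n = trans (cong (λ i → choose a j * choosePred i 0) (m∸n≡suc[m∸suc[n]] a<n)) (*-zeroʳ (choose a j))
vandermonde′ zero    j (suc q) = begin
  choose 0 j * 0 + 0        ≡⟨ trans (+-identityʳ _) (*-zeroʳ (choose 0 j)) ⟩
  0                         ≡⟨ choose-vanish 0 (j + suc q) (subst (0 <_) (sym (+-suc j q)) z<s) ⟨
  choose 0 (j + suc q)      ∎
vandermonde′ (suc n) j (suc q) = begin
  Σ< (2 + n) (λ a → choose a j * choosePred (suc n ∸ a) (suc q))
    ≡⟨ Σ<-suc (suc n) (λ a → choose a j * choosePred (suc n ∸ a) (suc q)) ⟩
  Σ< (suc n) (λ a → choose a j * choosePred (suc n ∸ a) (suc q)) + choose (suc n) j * choosePred (suc n ∸ suc n) (suc q)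
    ≡⟨ cong₂ _+_ (Σ<-cong (suc n) (λ a a< → cong (λ i → choose a j * choosePred i (suc q)) (m∸n≡suc[m∸suc[n]] a<)))
                 (trans (cong (λ i → choose (suc n) j * choosePred i (suc q)) (n∸n≡0 n)) (*-zeroʳ (choose (suc n) j))) ⟩
  Σ< (suc n) (λ a → choose a j * choose (n ∸ a) q) + 0 ≡⟨ +-identityʳ _ ⟩
  Σ< (suc n) (λ a → choose a j * choose (n ∸ a) q)     ≡⟨ vandermonde n j q ⟩
  choose (suc n) (suc (j + q))                         ≡⟨ cong (choose (suc n)) (+-suc j q) ⟨
  choose (suc n) (j + suc q)                           ∎

factStirling : ℕ → ℕ → ℕ
factStirling zero    zero    = 1
factStirling (suc j) zero    = 0
factStirling zero    (suc q) = factStirling zero q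
factStirling (suc j) (suc q) = (2 + j) * factStirling (suc j) q + suc j * factStirling j q

factStirling≡ : ∀ j q → factStirling j q ≡ j ! * S (suc q) (suc j)
factStirling≡ zero    zero    = refl
factStirling≡ (suc j) zero    = sym (trans (cong (λ s → suc j ! * (s + 0)) (*-zeroʳ (2 + j))) (*-zeroʳ (suc j !)))
factStirling≡ zero    (suc q) = trans (factStirling≡ zero q) (cong (1 *_) (sym (trans (+-identityʳ _) (*-identityˡ _))))
factStirling≡ (suc j) (suc q) =
  trans (cong₂ (λ u v → (2 + j) * u + suc j * v) (factStirling≡ (suc j) q) (factStirling≡ j q))
        (regroup j (j !) (S (suc q) (2 + j)) (S (suc q) (suc j)))
  where
  regroup : ∀ j f s₁ s₂ → (2 + j) * ((1 + j) * f * s₁) + (1 + j) * (f * s₂) ≡ (1 + j) * f * ((2 + j) * s₁ + s₂)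
  regroup = solve-∀

factStirling-vanish : ∀ j q → q < j → factStirling j q ≡ 0
factStirling-vanish (suc j) zero    _         = refl
factStirling-vanish (suc j) (suc q) (s<s q<j) =
  cong₂ _+_ (trans (cong ((2 + j) *_) (factStirling-vanish (suc j) q (m<n⇒m<1+n q<j))) (*-zeroʳ (2 + j)))
            (trans (cong (suc j *_) (factStirling-vanish j q q<j)) (*-zeroʳ (suc j)))

-- Both sides count maps from q points to a+1 colours: add a point, take the blocks of the
-- partition induced on the q+1 points, and colour the j blocks avoiding the new point injectively.
Σ-choose-factStirling : ∀ a q m → q < m → Σ< m (λ j → choose a j * factStirling j q) ≡ suc a ^ q
Σ-choose-factStirling a zero (suc m) _ =
  cong₂ _+_ (cong (_* 1) (choose-zero a)) (Σ<-zero m _ (λ j _ → *-zeroʳ (choose a (suc j))))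
Σ-choose-factStirling a (suc q) (suc m) (s<s q<m) = begin
  Σ< (suc m) (λ j → choose a j * factStirling j (suc q))
    ≡⟨ Σ<-cong (suc m) (λ j _ → trans (cong (choose a j *_) (factStirling-suc j)) (*-distribˡ-+ (choose a j) (suc j * P j) (lower j))) ⟩
  Σ< (suc m) (λ j → choose a j * (suc j * P j) + choose a j * lower j)
    ≡⟨ Σ<-+ (suc m) (λ j → choose a j * (suc j * P j)) (λ j → choose a j * lower j) ⟩
  Σ< (suc m) (λ j → choose a j * (suc j * P j)) + (choose a 0 * 0 + Σ< m (λ j → choose a (suc j) * (suc j * P j)))
    ≡⟨ cong (Σ< (suc m) (λ j → choose a j * (suc j * P j)) +_) shift-lower ⟩
  Σ< (suc m) (λ j → choose a j * (suc j * P j)) + Σ< (suc m) (λ j → choose a (suc j) * (suc j * P j))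
    ≡⟨ Σ<-+ (suc m) (λ j → choose a j * (suc j * P j)) (λ j → choose a (suc j) * (suc j * P j)) ⟨
  Σ< (suc m) (λ j → choose a j * (suc j * P j) + choose a (suc j) * (suc j * P j))
    ≡⟨ Σ<-cong (suc m) (λ j _ → absorb j) ⟩
  Σ< (suc m) (λ j → suc a * (choose a j * P j))
    ≡⟨ Σ<-*ˡ (suc m) (suc a) (λ j → choose a j * P j) ⟩
  suc a * Σ< (suc m) (λ j → choose a j * P j)
    ≡⟨ cong (suc a *_) (Σ-choose-factStirling a q (suc m) (m<n⇒m<1+n q<m)) ⟩
  suc a * suc a ^ q ∎
  where
  P : ℕ → ℕ
  P j = factStirling j q
  lower : ℕ → ℕ
  lower zero    = 0
  lower (suc j) = suc j * P j
  factStirling-suc : ∀ j → factStirling j (suc q) ≡ suc j * P j + lower j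
  factStirling-suc zero    = sym (trans (+-identityʳ _) (+-identityʳ _))
  factStirling-suc (suc j) = refl
  shift-lower : choose a 0 * 0 + Σ< m (λ j → choose a (suc j) * (suc j * P j))
              ≡ Σ< (suc m) (λ j → choose a (suc j) * (suc j * P j))
  shift-lower = begin
    choose a 0 * 0 + Σ< m (λ j → choose a (suc j) * (suc j * P j))
      ≡⟨ cong (_+ Σ< m (λ j → choose a (suc j) * (suc j * P j))) (*-zeroʳ (choose a 0)) ⟩
    Σ< m (λ j → choose a (suc j) * (suc j * P j))
      ≡⟨ +-identityʳ _ ⟨
    Σ< m (λ j → choose a (suc j) * (suc j * P j)) + 0
      ≡⟨ cong (Σ< m (λ j → choose a (suc j) * (suc j * P j)) +_) last≡0 ⟨
    Σ< m (λ j → choose a (suc j) * (suc j * P j)) + choose a (suc m) * (suc m * P m)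
      ≡⟨ Σ<-suc m (λ j → choose a (suc j) * (suc j * P j)) ⟨
    Σ< (suc m) (λ j → choose a (suc j) * (suc j * P j)) ∎
    where
    last≡0 : choose a (suc m) * (suc m * P m) ≡ 0
    last≡0 rewrite factStirling-vanish m q q<m | *-zeroʳ (suc m) = *-zeroʳ (choose a (suc m))
  absorb : ∀ j → choose a j * (suc j * P j) + choose a (suc j) * (suc j * P j) ≡ suc a * (choose a j * P j)
  absorb j = begin
    choose a j * (suc j * P j) + choose a (suc j) * (suc j * P j) ≡⟨ factor (choose a j) (choose a (suc j)) (suc j) (P j) ⟩
    suc j * (choose a j + choose a (suc j)) * P j                 ≡⟨ cong (_* P j) (choose-absorb a j) ⟩
    suc a * choose a j * P j                                        ≡⟨ *-assoc (suc a) (choose a j) (P j) ⟩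
    suc a * (choose a j * P j)                                      ∎
    where
    factor : ∀ b₁ b₂ k p → b₁ * (k * p) + b₂ * (k * p) ≡ k * (b₁ + b₂) * p
    factor = solve-∀

binomial-theorem : ∀ n x m → n < m → Σ< m (λ q → choose n q * x ^ q) ≡ suc x ^ n
binomial-theorem zero    x (suc m) _         = cong suc (Σ<-zero m _ (λ _ _ → refl))
binomial-theorem (suc n) x (suc m) (s<s n<m) = begin
  1 * 1 + Σ< m (λ q → (choose n q + choose n (suc q)) * (x * x ^ q))
    ≡⟨ cong (1 +_) (trans (Σ<-cong m (λ q _ → split (choose n q) (choose n (suc q)) x (x ^ q))) (Σ<-+ m _ _)) ⟩
  1 + (Σ< m (λ q → x * (choose n q * x ^ q)) + Σ< m (λ q → choose n (suc q) * (x * x ^ q)))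
    ≡⟨ cong (λ s → 1 + (s + Σ< m (λ q → choose n (suc q) * (x * x ^ q))))
            (trans (Σ<-*ˡ m x _) (cong (x *_) (binomial-theorem n x m n<m))) ⟩
  1 + (x * suc x ^ n + Σ< m (λ q → choose n (suc q) * (x * x ^ q)))
    ≡⟨ rotate (x * suc x ^ n) (Σ< m (λ q → choose n (suc q) * (x * x ^ q))) ⟩
  (1 + Σ< m (λ q → choose n (suc q) * (x * x ^ q))) + x * suc x ^ n
    ≡⟨ cong (λ c → (c * 1 + Σ< m (λ q → choose n (suc q) * (x * x ^ q))) + x * suc x ^ n) (choose-zero n) ⟨
  (choose n 0 * 1 + Σ< m (λ q → choose n (suc q) * (x * x ^ q))) + x * suc x ^ n
    ≡⟨ cong (_+ x * suc x ^ n) (binomial-theorem n x (suc m) (m<n⇒m<1+n n<m)) ⟩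
  suc x ^ n + x * suc x ^ n ∎
  where
  split : ∀ b₁ b₂ x y → (b₁ + b₂) * (x * y) ≡ x * (b₁ * y) + b₂ * (x * y)
  split = solve-∀
  rotate : ∀ u v → 1 + (u + v) ≡ (1 + v) + u
  rotate = solve-∀

-- coeff i r is the coefficient of t^r in (1 − t)/(1 − (i+1)t).
coeff : ℕ → ℕ → ℕ
coeff i zero    = 1
coeff i (suc r) = i * suc i ^ r

Σ-choosePred-power : ∀ r a m → r < m → Σ< m (λ q → choosePred r q * suc a ^ q) ≡ coeff (suc a) r
Σ-choosePred-power zero    a (suc m) _         = cong suc (Σ<-zero m _ (λ _ _ → refl))
Σ-choosePred-power (suc r) a (suc m) (s<s r<m) = begin
  Σ< m (λ q → choose r q * (suc a * suc a ^ q)) ≡⟨ Σ<-cong m (λ q _ → x∙yz≈y∙xz (choose r q) (suc a) (suc a ^ q)) ⟩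
  Σ< m (λ q → suc a * (choose r q * suc a ^ q)) ≡⟨ Σ<-*ˡ m (suc a) _ ⟩
  suc a * Σ< m (λ q → choose r q * suc a ^ q)   ≡⟨ cong (suc a *_) (binomial-theorem r (suc a) m r<m) ⟩
  suc a * (2 + a) ^ r                           ∎
  where
  x∙yz≈y∙xz : ∀ x y z → x * (y * z) ≡ y * (x * z)
  x∙yz≈y∙xz = solve-∀

-- count (suc n) unfolds to Σ_{a ≤ n} coeff (suc a) (n − a), since coeff 0 (suc n) reduces to 0.
count : ℕ → ℕ
count n = Σ< (suc n) (λ i → coeff i (n ∸ i))

formula≡double-sum : ∀ n → formula (suc n) ≡ Σ< (suc n) (λ j → Σ< (suc n) (λ q → choose n (j + q) * factStirling j q))
formula≡double-sum n = begin
  Σ< (suc n) (λ k → (n C k) * Σ< (suc k) (λ j → j ! * S (k ∸ j + 1) (suc j)))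
    ≡⟨ Σ<-cong (suc n) (λ k _ → diagonal k) ⟩
  Σ< (suc n) (λ k → Σ< (suc k) (λ j → h j (k ∸ j)))
    ≡⟨ Σ<-triangle (suc n) h ⟩
  Σ< (suc n) (λ j → Σ< (suc n ∸ j) (h j))
    ≡⟨ Σ<-cong (suc n) (λ j _ → Σ<-vanishing-tail (suc n ∸ j) (suc n) (h j) (m∸n≤m (suc n) j) (λ q le _ → h-vanish j q le)) ⟨
  Σ< (suc n) (λ j → Σ< (suc n) (h j)) ∎
  where
  h : ℕ → ℕ → ℕ
  h j q = choose n (j + q) * factStirling j q
  h-vanish : ∀ j q → suc n ∸ j ≤ q → h j q ≡ 0
  h-vanish j q le = cong (_* factStirling j q) (choose-vanish n (j + q) (≤-trans (m≤n+m∸n (suc n) j) (+-monoʳ-≤ j le)))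
  diagonal : ∀ k → (n C k) * Σ< (suc k) (λ j → j ! * S (k ∸ j + 1) (suc j)) ≡ Σ< (suc k) (λ j → h j (k ∸ j))
  diagonal k = trans (sym (Σ<-*ˡ (suc k) (n C k) (λ j → j ! * S (k ∸ j + 1) (suc j)))) (Σ<-cong (suc k) (λ j j≤k → cong₂ _*_
    (trans (sym (choose≡C n k)) (cong (choose n) (sym (m+[n∸m]≡n (≤-pred j≤k)))))
    (trans (cong (λ i → j ! * S i (suc j)) (+-comm (k ∸ j) 1)) (sym (factStirling≡ j (k ∸ j))))))

double-sum≡count : ∀ n → Σ< (suc n) (λ j → Σ< (suc n) (λ q → choose n (j + q) * factStirling j q)) ≡ count (suc n)
double-sum≡count n = begin
  Σ< (suc n) (λ j → Σ< (suc n) (λ q → choose n (j + q) * factStirling j q))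
    ≡⟨ Σ<-cong (suc n) (λ j _ → Σ<-cong (suc n) (λ q _ → expand j q)) ⟩
  Σ< (suc n) (λ j → Σ< (suc n) (λ q → Σ< (suc n) (λ a → T a j q)))
    ≡⟨ Σ<-cong (suc n) (λ j _ → Σ<-comm (suc n) (suc n) (λ q a → T a j q)) ⟩
  Σ< (suc n) (λ j → Σ< (suc n) (λ a → Σ< (suc n) (λ q → T a j q)))
    ≡⟨ Σ<-comm (suc n) (suc n) (λ j a → Σ< (suc n) (λ q → T a j q)) ⟩
  Σ< (suc n) (λ a → Σ< (suc n) (λ j → Σ< (suc n) (λ q → T a j q)))
    ≡⟨ Σ<-cong (suc n) (λ a _ → Σ<-comm (suc n) (suc n) (T a)) ⟩
  Σ< (suc n) (λ a → Σ< (suc n) (λ q → Σ< (suc n) (λ j → T a j q)))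
    ≡⟨ Σ<-cong (suc n) (λ a _ → Σ<-cong (suc n) (λ q q< → inner a q q<)) ⟩
  Σ< (suc n) (λ a → Σ< (suc n) (λ q → choosePred (n ∸ a) q * suc a ^ q))
    ≡⟨ Σ<-cong (suc n) (λ a _ → Σ-choosePred-power (n ∸ a) a (suc n) (s≤s (m∸n≤m n a))) ⟩
  Σ< (suc n) (λ a → coeff (suc a) (n ∸ a)) ∎
  where
  T : ℕ → ℕ → ℕ → ℕ
  T a j q = choose a j * choosePred (n ∸ a) q * factStirling j q
  expand : ∀ j q → choose n (j + q) * factStirling j q ≡ Σ< (suc n) (λ a → T a j q)
  expand j q = trans (cong (_* factStirling j q) (sym (vandermonde′ n j q)))
                     (sym (Σ<-*ʳ (suc n) (factStirling j q) (λ a → choose a j * choosePred (n ∸ a) q)))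
  inner : ∀ a q → q < suc n → Σ< (suc n) (λ j → T a j q) ≡ choosePred (n ∸ a) q * suc a ^ q
  inner a q q< = begin
    Σ< (suc n) (λ j → T a j q)
      ≡⟨ Σ<-cong (suc n) (λ j _ → reassoc (choose a j) (choosePred (n ∸ a) q) (factStirling j q)) ⟩
    Σ< (suc n) (λ j → choosePred (n ∸ a) q * (choose a j * factStirling j q))
      ≡⟨ Σ<-*ˡ (suc n) (choosePred (n ∸ a) q) (λ j → choose a j * factStirling j q) ⟩
    choosePred (n ∸ a) q * Σ< (suc n) (λ j → choose a j * factStirling j q)
      ≡⟨ cong (choosePred (n ∸ a) q *_) (Σ-choose-factStirling a q (suc n) q<) ⟩
    choosePred (n ∸ a) q * suc a ^ q ∎
    where
    reassoc : ∀ b d p → b * d * p ≡ d * (b * p)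
    reassoc = solve-∀

formula≡count : ∀ n → formula (suc n) ≡ count (suc n)
formula≡count n = trans (formula≡double-sum n) (double-sum≡count n)

module _ where
  open import Data.Integer using (+_)

  sumℤ : List ℤ → ℤ
  sumℤ = foldr ℤ._+_ (+ 0)

  sumℤ-cong : ∀ n {f g : ℕ → ℤ} → (∀ i → i < n → f i ≡ g i) → sumℤ (applyUpTo f n) ≡ sumℤ (applyUpTo g n)
  sumℤ-cong zero    eq = refl
  sumℤ-cong (suc n) eq = cong₂ ℤ._+_ (eq 0 z<s) (sumℤ-cong n (λ i i<n → eq (suc i) (s<s i<n)))

  sumℤ-+ : ∀ n g → sumℤ (applyUpTo (λ i → + g i) n) ≡ + Σ< n g
  sumℤ-+ zero    g = refl
  sumℤ-+ (suc n) g = cong (ℤ._+_ (+ g 0)) (sumℤ-+ n (g ∘ suc))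

  sumℤ-zero : ∀ n f → (∀ i → i < n → f i ≡ + 0) → sumℤ (applyUpTo f n) ≡ + 0
  sumℤ-zero zero    f eq = refl
  sumℤ-zero (suc n) f eq = cong₂ ℤ._+_ (eq 0 z<s) (sumℤ-zero n (f ∘ suc) (λ i i<n → eq (suc i) (s<s i<n)))

  sumℤ-single : ∀ n f k → k < n → (∀ i → i < n → i ≢ k → f i ≡ + 0) → sumℤ (applyUpTo f n) ≡ f k
  sumℤ-single (suc n) f zero    _         others≡0 =
    trans (cong (ℤ._+_ (f 0)) (sumℤ-zero n (f ∘ suc) (λ i i<n → others≡0 (suc i) (s<s i<n) (λ ())))) (ℤ.+-identityʳ (f 0))
  sumℤ-single (suc n) f (suc k) (s<s k<n) others≡0 =
    trans (cong (ℤ._+ sumℤ (applyUpTo (f ∘ suc) n)) (others≡0 0 z<s (λ ())))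
          (trans (ℤ.+-identityˡ _)
                 (sumℤ-single n (f ∘ suc) k k<n (λ i i<n i≢k → others≡0 (suc i) (s<s i<n) (i≢k ∘ suc-injective))))

  tPow-≡ : ∀ i → tPow i i ≡ + 1
  tPow-≡ i with i ≟ i
  ... | yes _  = refl
  ... | no i≢i = ⊥-elim (i≢i refl)

  tPow-≢ : ∀ i k → i ≢ k → tPow i k ≡ + 0
  tPow-≢ i k i≢k with i ≟ k
  ... | yes i≡k = ⊥-elim (i≢k i≡k)
  ... | no _    = refl

  tPow-· : ∀ i n (h : FPS) → i ≤ n → (tPow i · h) n ≡ h (n ∸ i)
  tPow-· i n h i≤n = begin
    sumℤ (applyUpTo (λ k → tPow i k ℤ.* h (n ∸ k)) (suc n)) ≡⟨ sumℤ-single (suc n) _ i (s≤s i≤n) off-diagonal ⟩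
    tPow i i ℤ.* h (n ∸ i)                                  ≡⟨ cong (ℤ._* h (n ∸ i)) (tPow-≡ i) ⟩
    + 1 ℤ.* h (n ∸ i)                                       ≡⟨ ℤ.*-identityˡ _ ⟩
    h (n ∸ i)                                               ∎
    where
    off-diagonal : ∀ k → k < suc n → k ≢ i → tPow i k ℤ.* h (n ∸ k) ≡ + 0
    off-diagonal k _ k≢i = trans (cong (ℤ._* h (n ∸ k)) (tPow-≢ i k (k≢i ∘ sym))) (ℤ.*-zeroˡ (h (n ∸ k)))

  [1-t]/[1-[1+i]t]-coeff : ∀ i r → (oneMinusT · geomInv (suc i)) r ≡ + coeff i r
  [1-t]/[1-[1+i]t]-coeff i zero    = refl
  [1-t]/[1-[1+i]t]-coeff i (suc r) = begin
    sumℤ (applyUpTo (λ k → oneMinusT k ℤ.* + (suc i ^ (suc r ∸ k))) (2 + r))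
      ≡⟨ cong (λ z → + 1 ℤ.* + (suc i ^ suc r) ℤ.+ (ℤ.- (+ 1) ℤ.* + (suc i ^ r) ℤ.+ z))
              (sumℤ-zero r _ (λ k _ → ℤ.*-zeroˡ (+ (suc i ^ (r ∸ suc k))))) ⟩
    + 1 ℤ.* + (suc i ^ suc r) ℤ.+ (ℤ.- (+ 1) ℤ.* + (suc i ^ r) ℤ.+ + 0)
      ≡⟨ cong₂ (λ u v → u ℤ.+ (v ℤ.+ + 0)) (ℤ.*-identityˡ (+ (suc i ^ suc r))) (ℤ.-1*i≡-i (+ (suc i ^ r))) ⟩
    (+ (suc i ^ r) ℤ.+ + (i * suc i ^ r)) ℤ.+ (ℤ.- (+ (suc i ^ r)) ℤ.+ + 0)
      ≡⟨ cancel (+ (suc i ^ r)) (+ (i * suc i ^ r)) ⟩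
    + (i * suc i ^ r) ∎
    where
    cancel : ∀ x y → (x ℤ.+ y) ℤ.+ (ℤ.- x ℤ.+ + 0) ≡ y
    cancel x y = begin
      (x ℤ.+ y) ℤ.+ (ℤ.- x ℤ.+ + 0) ≡⟨ cong (ℤ._+_ (x ℤ.+ y)) (ℤ.+-identityʳ (ℤ.- x)) ⟩
      (x ℤ.+ y) ℤ.+ ℤ.- x           ≡⟨ cong (ℤ._+ ℤ.- x) (ℤ.+-comm x y) ⟩
      (y ℤ.+ x) ℤ.+ ℤ.- x           ≡⟨ ℤ.+-assoc y x (ℤ.- x) ⟩
      y ℤ.+ (x ℤ.+ ℤ.- x)           ≡⟨ cong (ℤ._+_ y) (ℤ.+-inverseʳ x) ⟩
      y ℤ.+ + 0                     ≡⟨ ℤ.+-identityʳ y ⟩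
      y                             ∎

  count≡gfSum : ∀ n → + count n ≡ gfSum n
  count≡gfSum n = sym (begin
    sumℤ (applyUpTo (λ i → gfTerm i n) (suc n))
      ≡⟨ sumℤ-cong (suc n) (λ i i≤n → trans (tPow-· i n (oneMinusT · geomInv (suc i)) (≤-pred i≤n)) ([1-t]/[1-[1+i]t]-coeff i (n ∸ i))) ⟩
    sumℤ (applyUpTo (λ i → + coeff i (n ∸ i)) (suc n))
      ≡⟨ sumℤ-+ (suc n) (λ i → coeff i (n ∸ i)) ⟩
    + count n ∎)

-- Tails of modified ascent sequences avoiding 1232

RiseOrReset : ℕ → Word → Set
RiseOrReset p [] = ⊤
RiseOrReset p (y ∷ ys) = (y ≡ 1 ⊎ p ≤ y) × RiseOrReset y ys

HeadIs : ℕ → Word → Set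
HeadIs y ys = Σ Word λ zs → ys ≡ y ∷ zs

Contiguous : Word → Set
Contiguous [] = ⊤
Contiguous (y ∷ ys) = (2 ≤ y → y ∈ ys → HeadIs y ys) × Contiguous ys

Below : ℕ → Word → Set
Below m xs = ∀ v → v ∈ xs → v ≤ m

Below-∷ : ∀ {m y ys} → Below m (y ∷ ys) → Below m ys
Below-∷ bound w w∈ = bound w (there w∈)

Covers : ℕ → Word → Set
Covers m xs = ∀ j → 1 ≤ j → j ≤ m → j ∈ (1 ∷ xs)

record Tail (m : ℕ) (xs : Word) : Set where
  constructor mkTail
  field
    1≤m         : 1 ≤ m
    riseOrReset : RiseOrReset 1 xs
    contiguous  : Contiguous xs
    below       : Below m xs
    covers      : Covers m xs

ones : Word → ℕ
ones [] = 0
ones (suc zero ∷ ys) = suc (ones ys)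
ones (zero ∷ ys) = ones ys
ones (suc (suc _) ∷ ys) = ones ys

others : Word → ℕ
others [] = 0
others (suc zero ∷ ys) = others ys
others (zero ∷ ys) = suc (others ys)
others (suc (suc _) ∷ ys) = suc (others ys)

-- insertAt v xs g inserts v just before the g-th 1 of xs (counting from 0), or at the end.
insertAt : ℕ → Word → ℕ → Word
insertAt v [] g = v ∷ []
insertAt v (suc zero ∷ ys) zero = v ∷ suc zero ∷ ys
insertAt v (suc zero ∷ ys) (suc g) = suc zero ∷ insertAt v ys g
insertAt v (zero ∷ ys) g = zero ∷ insertAt v ys g
insertAt v (suc (suc y) ∷ ys) g = suc (suc y) ∷ insertAt v ys g

duplicate : ℕ → Word → Word
duplicate m [] = []
duplicate m (y ∷ ys) with m ≟ y
... | yes _ = m ∷ y ∷ ys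
... | no _ = y ∷ duplicate m ys

remove : ℕ → Word → Word
remove m [] = []
remove m (y ∷ ys) with m ≟ y
... | yes _ = ys
... | no _ = y ∷ remove m ys

onesBefore : ℕ → Word → ℕ
onesBefore m [] = 0
onesBefore m (y ∷ ys) with m ≟ y
... | yes _ = 0
... | no _ with y ≟ 1
... | yes _ = suc (onesBefore m ys)
... | no _ = onesBefore m ys

∈-insertAt⁻ : ∀ {w} v xs g → w ∈ insertAt v xs g → w ≡ v ⊎ w ∈ xs
∈-insertAt⁻ v [] g (here e) = inj₁ e
∈-insertAt⁻ v (suc zero ∷ ys) zero (here e) = inj₁ e
∈-insertAt⁻ v (suc zero ∷ ys) zero (there p) = inj₂ p
∈-insertAt⁻ v (suc zero ∷ ys) (suc g) (here e) = inj₂ (here e)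
∈-insertAt⁻ v (suc zero ∷ ys) (suc g) (there p) with ∈-insertAt⁻ v ys g p
... | inj₁ e = inj₁ e
... | inj₂ q = inj₂ (there q)
∈-insertAt⁻ v (zero ∷ ys) g (here e) = inj₂ (here e)
∈-insertAt⁻ v (zero ∷ ys) g (there p) with ∈-insertAt⁻ v ys g p
... | inj₁ e = inj₁ e
... | inj₂ q = inj₂ (there q)
∈-insertAt⁻ v (suc (suc y) ∷ ys) g (here e) = inj₂ (here e)
∈-insertAt⁻ v (suc (suc y) ∷ ys) g (there p) with ∈-insertAt⁻ v ys g p
... | inj₁ e = inj₁ e
... | inj₂ q = inj₂ (there q)

∈-insertAt-new : ∀ v xs g → v ∈ insertAt v xs g
∈-insertAt-new v [] g = here refl
∈-insertAt-new v (suc zero ∷ ys) zero = here refl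
∈-insertAt-new v (suc zero ∷ ys) (suc g) = there (∈-insertAt-new v ys g)
∈-insertAt-new v (zero ∷ ys) g = there (∈-insertAt-new v ys g)
∈-insertAt-new v (suc (suc y) ∷ ys) g = there (∈-insertAt-new v ys g)

∈-insertAt⁺ : ∀ {w} v xs g → w ∈ xs → w ∈ insertAt v xs g
∈-insertAt⁺ v (suc zero ∷ ys) zero p = there p
∈-insertAt⁺ v (suc zero ∷ ys) (suc g) (here e) = here e
∈-insertAt⁺ v (suc zero ∷ ys) (suc g) (there p) = there (∈-insertAt⁺ v ys g p)
∈-insertAt⁺ v (zero ∷ ys) g (here e) = here e
∈-insertAt⁺ v (zero ∷ ys) g (there p) = there (∈-insertAt⁺ v ys g p)
∈-insertAt⁺ v (suc (suc y) ∷ ys) g (here e) = here e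
∈-insertAt⁺ v (suc (suc y) ∷ ys) g (there p) = there (∈-insertAt⁺ v ys g p)

∈-duplicate⁻ : ∀ {w} m xs → w ∈ duplicate m xs → w ≡ m ⊎ w ∈ xs
∈-duplicate⁻ m (y ∷ ys) p with m ≟ y
∈-duplicate⁻ m (y ∷ ys) (here e) | yes _ = inj₁ e
∈-duplicate⁻ m (y ∷ ys) (there p) | yes _ = inj₂ p
∈-duplicate⁻ m (y ∷ ys) (here e) | no _ = inj₂ (here e)
∈-duplicate⁻ m (y ∷ ys) (there p) | no _ with ∈-duplicate⁻ m ys p
... | inj₁ e = inj₁ e
... | inj₂ q = inj₂ (there q)

∈-duplicate⁺ : ∀ {w} m xs → w ∈ xs → w ∈ duplicate m xs
∈-duplicate⁺ m (y ∷ ys) p with m ≟ y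
... | yes _ = there p
∈-duplicate⁺ m (y ∷ ys) (here e) | no _ = here e
∈-duplicate⁺ m (y ∷ ys) (there p) | no _ = there (∈-duplicate⁺ m ys p)

∈-remove⁻ : ∀ {w} m xs → w ∈ remove m xs → w ∈ xs
∈-remove⁻ m (y ∷ ys) p with m ≟ y
... | yes _ = there p
∈-remove⁻ m (y ∷ ys) (here e) | no _ = here e
∈-remove⁻ m (y ∷ ys) (there p) | no _ = there (∈-remove⁻ m ys p)

∈-remove⁺ : ∀ {w} m xs → w ∈ xs → ¬ w ≡ m → w ∈ remove m xs
∈-remove⁺ m (y ∷ ys) p ne with m ≟ y
∈-remove⁺ m (y ∷ ys) (here e) ne | yes e' = ⊥-elim (ne (trans e (sym e')))
∈-remove⁺ m (y ∷ ys) (there p) ne | yes _ = p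
∈-remove⁺ m (y ∷ ys) (here e) ne | no _ = here e
∈-remove⁺ m (y ∷ ys) (there p) ne | no _ = there (∈-remove⁺ m ys p ne)

duplicate-here : ∀ {m y} ys → m ≡ y → duplicate m (y ∷ ys) ≡ m ∷ y ∷ ys
duplicate-here {m} {y} ys e with m ≟ y
... | yes _ = refl
... | no ne = ⊥-elim (ne e)

duplicate-there : ∀ {m y} ys → ¬ m ≡ y → duplicate m (y ∷ ys) ≡ y ∷ duplicate m ys
duplicate-there {m} {y} ys ne with m ≟ y
... | yes e = ⊥-elim (ne e)
... | no _ = refl

remove-here : ∀ {m y} ys → m ≡ y → remove m (y ∷ ys) ≡ ys
remove-here {m} {y} ys e with m ≟ y
... | yes _ = refl
... | no ne = ⊥-elim (ne e)

remove-there : ∀ {m y} ys → ¬ m ≡ y → remove m (y ∷ ys) ≡ y ∷ remove m ys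
remove-there {m} {y} ys ne with m ≟ y
... | yes e = ⊥-elim (ne e)
... | no _ = refl

onesBefore-here : ∀ {m y} ys → m ≡ y → onesBefore m (y ∷ ys) ≡ 0
onesBefore-here {m} {y} ys e with m ≟ y
... | yes _ = refl
... | no ne = ⊥-elim (ne e)

onesBefore-one : ∀ {m} ys → ¬ m ≡ 1 → onesBefore m (1 ∷ ys) ≡ suc (onesBefore m ys)
onesBefore-one {m} ys ne with m ≟ 1
... | yes e = ⊥-elim (ne e)
... | no _ = refl

onesBefore-other : ∀ {m y} ys → ¬ m ≡ y → ¬ y ≡ 1 → onesBefore m (y ∷ ys) ≡ onesBefore m ys
onesBefore-other {m} {y} ys ne ne1 with m ≟ y
... | yes e = ⊥-elim (ne e)
... | no _ with y ≟ 1
... | yes e = ⊥-elim (ne1 e)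
... | no _ = refl

RiseOrReset-weaken : ∀ {p q} xs → q ≤ p → RiseOrReset p xs → RiseOrReset q xs
RiseOrReset-weaken [] _ _ = tt
RiseOrReset-weaken (y ∷ ys) q≤p (inj₁ e , a) = inj₁ e , a
RiseOrReset-weaken (y ∷ ys) q≤p (inj₂ p≤y , a) = inj₂ (≤-trans q≤p p≤y) , a

RiseOrReset-insertAt : ∀ p v xs g → p ≤ v → Below v xs → RiseOrReset p xs → RiseOrReset p (insertAt v xs g)
RiseOrReset-insertAt p v [] g p≤v bound rise = inj₂ p≤v , tt
RiseOrReset-insertAt p v (suc zero ∷ ys) zero p≤v bound (a , rise) = inj₂ p≤v , (inj₁ refl , rise)
RiseOrReset-insertAt p v (suc zero ∷ ys) (suc g) p≤v bound (a , rise) =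
  a , RiseOrReset-insertAt 1 v ys g (bound 1 (here refl)) (Below-∷ bound) rise
RiseOrReset-insertAt p v (zero ∷ ys) g p≤v bound (a , rise) = a , RiseOrReset-insertAt 0 v ys g z≤n (Below-∷ bound) rise
RiseOrReset-insertAt p v (suc (suc y) ∷ ys) g p≤v bound (a , rise) =
  a , RiseOrReset-insertAt (suc (suc y)) v ys g (bound _ (here refl)) (Below-∷ bound) rise

RiseOrReset-duplicate : ∀ p m xs → p ≤ m → Below m xs → RiseOrReset p xs → RiseOrReset p (duplicate m xs)
RiseOrReset-duplicate p m [] p≤m bound rise = tt
RiseOrReset-duplicate p m (y ∷ ys) p≤m bound (a , rise) with m ≟ y
... | yes e = inj₂ p≤m , (inj₂ (≤-reflexive e) , rise)
... | no _ = a , RiseOrReset-duplicate y m ys (bound y (here refl)) (Below-∷ bound) rise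

RiseOrReset-remove : ∀ p m xs → p ≤ m → Below m xs → RiseOrReset p xs → RiseOrReset p (remove m xs)
RiseOrReset-remove p m [] p≤m bound rise = tt
RiseOrReset-remove p m (y ∷ ys) p≤m bound (a , rise) with m ≟ y
... | yes e = RiseOrReset-weaken ys (≤-trans p≤m (≤-reflexive e)) rise
... | no _ = a , RiseOrReset-remove y m ys (bound y (here refl)) (Below-∷ bound) rise

Contiguous-insertAt : ∀ v xs g → v ∉ xs → (∀ w → w ∈ xs → w < v) → Contiguous xs → Contiguous (insertAt v xs g)
Contiguous-insertAt v [] g _ _ _ = (λ _ ()) , tt
Contiguous-insertAt v (suc zero ∷ ys) zero v∉ _ blocks = (λ _ v∈ → ⊥-elim (v∉ v∈)) , blocks
Contiguous-insertAt v (suc zero ∷ ys) (suc g) v∉ bound (block , blocks) =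
  (λ { (s≤s ()) }) , Contiguous-insertAt v ys g (v∉ ∘ there) (λ w w∈ → bound w (there w∈)) blocks
Contiguous-insertAt v (zero ∷ ys) g v∉ bound (block , blocks) =
  (λ ()) , Contiguous-insertAt v ys g (v∉ ∘ there) (λ w w∈ → bound w (there w∈)) blocks
Contiguous-insertAt v (suc (suc y) ∷ ys) g v∉ bound (block , blocks) =
  hd , Contiguous-insertAt v ys g (v∉ ∘ there) (λ w w∈ → bound w (there w∈)) blocks
  where
  hd : 2 ≤ suc (suc y) → suc (suc y) ∈ insertAt v ys g → HeadIs (suc (suc y)) (insertAt v ys g)
  hd le p with ∈-insertAt⁻ v ys g p
  ... | inj₁ e = ⊥-elim (<-irrefl e (bound _ (here refl)))
  ... | inj₂ q with block le q
  ... | zs , refl = insertAt v zs g , refl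

Contiguous-duplicate : ∀ m xs → m ∈ xs → Contiguous xs → Contiguous (duplicate m xs)
Contiguous-duplicate m (y ∷ ys) m∈ (block , blocks) with m ≟ y
... | yes e = (λ _ _ → ys , cong (_∷ ys) (sym e)) , (block , blocks)
... | no ne = hd , Contiguous-duplicate m ys m∈' blocks
  where
  m∈' : m ∈ ys
  m∈' = tl m∈
    where
    tl : m ∈ y ∷ ys → m ∈ ys
    tl (here e) = ⊥-elim (ne e)
    tl (there q) = q
  hd : 2 ≤ y → y ∈ duplicate m ys → HeadIs y (duplicate m ys)
  hd le p with ∈-duplicate⁻ m ys p
  ... | inj₁ e = ⊥-elim (ne (sym e))
  ... | inj₂ q with block le q
  ... | zs , refl = duplicate m zs , duplicate-there zs ne

Contiguous-remove : ∀ m xs → Contiguous xs → Contiguous (remove m xs)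
Contiguous-remove m [] blocks = tt
Contiguous-remove m (y ∷ ys) (block , blocks) with m ≟ y
... | yes e = blocks
... | no ne = hd , Contiguous-remove m ys blocks
  where
  hd : 2 ≤ y → y ∈ remove m ys → HeadIs y (remove m ys)
  hd le p with block le (∈-remove⁻ m ys p)
  ... | zs , refl = remove m zs , remove-there zs ne

2≤⇒≢1 : ∀ {m} → 2 ≤ m → ¬ m ≡ 1
2≤⇒≢1 (s≤s ()) refl

Tail-duplicate : ∀ {m xs} → Tail m xs → 2 ≤ m → m ∈ xs × Tail m (duplicate m xs)
Tail-duplicate {m} {xs} (mkTail 1≤m rise blocks bound cover) 2≤m =
  m∈ , mkTail 1≤m (RiseOrReset-duplicate 1 m xs 1≤m bound rise) (Contiguous-duplicate m xs m∈ blocks) bound′ cover′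
  where
  m∈ : m ∈ xs
  m∈ with cover m 1≤m ≤-refl
  ... | here e = ⊥-elim (2≤⇒≢1 2≤m e)
  ... | there q = q
  bound′ : Below m (duplicate m xs)
  bound′ w p with ∈-duplicate⁻ m xs p
  ... | inj₁ e = ≤-reflexive e
  ... | inj₂ q = bound w q
  cover′ : Covers m (duplicate m xs)
  cover′ j a b with cover j a b
  ... | here e = here e
  ... | there q = there (∈-duplicate⁺ m xs q)

Tail-insertAt : ∀ {m xs} g → Tail m xs → Tail (suc m) (insertAt (suc m) xs g)
Tail-insertAt {m} {xs} g (mkTail 1≤m rise blocks bound cover) =
  mkTail (s≤s z≤n) (RiseOrReset-insertAt 1 (suc m) xs g (s≤s z≤n) (λ w w∈ → m≤n⇒m≤1+n (bound w w∈)) rise)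
         (Contiguous-insertAt (suc m) xs g (λ p → 1+n≰n (bound _ p)) (λ w w∈ → s≤s (bound w w∈)) blocks) bound′ cover′
  where
  bound′ : Below (suc m) (insertAt (suc m) xs g)
  bound′ w p with ∈-insertAt⁻ (suc m) xs g p
  ... | inj₁ e = ≤-reflexive e
  ... | inj₂ q = m≤n⇒m≤1+n (bound w q)
  cover′ : Covers (suc m) (insertAt (suc m) xs g)
  cover′ j a b with m≤n⇒m<n∨m≡n b
  ... | inj₂ e = there (subst (_∈ insertAt (suc m) xs g) (sym e) (∈-insertAt-new (suc m) xs g))
  ... | inj₁ (s≤s j≤m) with cover j a j≤m
  ... | here e = here e
  ... | there q = there (∈-insertAt⁺ (suc m) xs g q)

Tail-remove-repeated : ∀ {m xs} → Tail m xs → m ∈ remove m xs → Tail m (remove m xs)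
Tail-remove-repeated {m} {xs} (mkTail 1≤m rise blocks bound cover) m∈ =
  mkTail 1≤m (RiseOrReset-remove 1 m xs 1≤m bound rise) (Contiguous-remove m xs blocks)
  (λ w p → bound w (∈-remove⁻ m xs p)) cover′
  where
  cover′ : Covers m (remove m xs)
  cover′ j a b with cover j a b
  ... | here e = here e
  ... | there q with j ≟ m
  ... | yes refl = there m∈
  ... | no ne = there (∈-remove⁺ m xs q ne)

Tail-remove-unique : ∀ {m xs} → Tail (suc m) xs → 1 ≤ m → suc m ∉ remove (suc m) xs → Tail m (remove (suc m) xs)
Tail-remove-unique {m} {xs} (mkTail _ rise blocks bound cover) 1≤m m∉ =
  mkTail 1≤m (RiseOrReset-remove 1 (suc m) xs (s≤s z≤n) bound rise) (Contiguous-remove (suc m) xs blocks) bound′ cover′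
  where
  bound′ : Below m (remove (suc m) xs)
  bound′ w p with m≤n⇒m<n∨m≡n (bound w (∈-remove⁻ (suc m) xs p))
  ... | inj₁ (s≤s le) = le
  ... | inj₂ refl = ⊥-elim (m∉ p)
  cover′ : Covers m (remove (suc m) xs)
  cover′ j a b with cover j a (m≤n⇒m≤1+n b)
  ... | here e = here e
  ... | there q = there (∈-remove⁺ (suc m) xs q (λ { refl → 1+n≰n b }))

duplicate-remove : ∀ m xs → 2 ≤ m → Contiguous xs → m ∈ remove m xs → duplicate m (remove m xs) ≡ xs
duplicate-remove m (y ∷ ys) 2≤m (block , blocks) m∈ with m ≟ y
... | yes refl with block 2≤m m∈
... | zs , refl = duplicate-here zs refl
duplicate-remove m (y ∷ ys) 2≤m (block , blocks) (here e) | no ne = ⊥-elim (ne e)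
duplicate-remove m (y ∷ ys) 2≤m (block , blocks) (there m∈) | no ne =
  trans (duplicate-there (remove m ys) ne) (cong (y ∷_) (duplicate-remove m ys 2≤m blocks m∈))

insertAt-remove : ∀ p m xs → 2 ≤ m → RiseOrReset p xs → Below m xs → m ∈ xs → m ∉ remove m xs →
                  insertAt m (remove m xs) (onesBefore m xs) ≡ xs
insertAt-remove p m (y ∷ ys) 2≤m (a , rise) bound m∈ m∉ with m ≟ y
insertAt-remove p m (y ∷ []) 2≤m (a , rise) bound m∈ m∉ | yes refl = refl
insertAt-remove p m (y ∷ z ∷ zs) 2≤m (a , (inj₁ refl , rise)) bound m∈ m∉ | yes refl = refl
insertAt-remove p m (y ∷ z ∷ zs) 2≤m (a , (inj₂ y≤z , rise)) bound m∈ m∉ | yes refl =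
  ⊥-elim (m∉ (here (≤-antisym y≤z (bound z (there (here refl))))))
insertAt-remove p m (y ∷ ys) 2≤m (a , rise) bound (here e) m∉ | no ne = ⊥-elim (ne e)
insertAt-remove p m (suc zero ∷ ys) 2≤m (a , rise) bound (there m∈) m∉ | no ne =
  (cong (1 ∷_) (insertAt-remove 1 m ys 2≤m rise (Below-∷ bound) m∈ (m∉ ∘ there)))
insertAt-remove p m (zero ∷ ys) 2≤m (a , rise) bound (there m∈) m∉ | no ne =
  (cong (0 ∷_) (insertAt-remove 0 m ys 2≤m rise (Below-∷ bound) m∈ (m∉ ∘ there)))
insertAt-remove p m (suc (suc y) ∷ ys) 2≤m (a , rise) bound (there m∈) m∉ | no ne =
  (cong (suc (suc y) ∷_) (insertAt-remove (suc (suc y)) m ys 2≤m rise (Below-∷ bound) m∈ (m∉ ∘ there)))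

remove-duplicate : ∀ m xs → remove m (duplicate m xs) ≡ xs
remove-duplicate m [] = refl
remove-duplicate m (y ∷ ys) with m ≟ y
... | yes e = remove-here (y ∷ ys) refl
... | no ne = trans (remove-there (duplicate m ys) ne) (cong (y ∷_) (remove-duplicate m ys))

remove-insertAt : ∀ v xs g → v ∉ xs → remove v (insertAt v xs g) ≡ xs
remove-insertAt v [] g _ = remove-here [] refl
remove-insertAt v (suc zero ∷ ys) zero _ = remove-here (1 ∷ ys) refl
remove-insertAt v (suc zero ∷ ys) (suc g) v∉ =
  trans (remove-there _ (v∉ ∘ here)) (cong (1 ∷_) (remove-insertAt v ys g (v∉ ∘ there)))
remove-insertAt v (zero ∷ ys) g v∉ = trans (remove-there _ (v∉ ∘ here)) (cong (0 ∷_) (remove-insertAt v ys g (v∉ ∘ there)))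
remove-insertAt v (suc (suc y) ∷ ys) g v∉ =
  trans (remove-there _ (v∉ ∘ here)) (cong (suc (suc y) ∷_) (remove-insertAt v ys g (v∉ ∘ there)))

onesBefore-insertAt : ∀ m xs g → 2 ≤ m → m ∉ xs → g ≤ ones xs → onesBefore m (insertAt m xs g) ≡ g
onesBefore-insertAt m [] zero _ _ _ = onesBefore-here {m} {m} [] refl
onesBefore-insertAt m (suc zero ∷ ys) zero _ _ _ = onesBefore-here {m} {m} (1 ∷ ys) refl
onesBefore-insertAt m (suc zero ∷ ys) (suc g) 2≤m m∉ (s≤s g≤) =
  trans (onesBefore-one _ (2≤⇒≢1 2≤m)) (cong suc (onesBefore-insertAt m ys g 2≤m (m∉ ∘ there) g≤))
onesBefore-insertAt m (zero ∷ ys) g 2≤m m∉ g≤ =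
  trans (onesBefore-other _ (m∉ ∘ here) (λ ())) (onesBefore-insertAt m ys g 2≤m (m∉ ∘ there) g≤)
onesBefore-insertAt m (suc (suc y) ∷ ys) g 2≤m m∉ g≤ =
  trans (onesBefore-other _ (m∉ ∘ here) (λ ())) (onesBefore-insertAt m ys g 2≤m (m∉ ∘ there) g≤)

onesBefore≤ones : ∀ m xs → ¬ m ≡ 1 → onesBefore m xs ≤ ones (remove m xs)
onesBefore≤ones m [] _ = z≤n
onesBefore≤ones m (y ∷ ys) ne1 with m ≟ y
... | yes _ = z≤n
onesBefore≤ones m (suc zero ∷ ys) ne1 | no ne = s≤s (onesBefore≤ones m ys ne1)
onesBefore≤ones m (zero ∷ ys) ne1 | no ne = onesBefore≤ones m ys ne1
onesBefore≤ones m (suc (suc y) ∷ ys) ne1 | no ne = onesBefore≤ones m ys ne1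

ones-insertAt : ∀ {v} xs g → 2 ≤ v → ones (insertAt v xs g) ≡ ones xs
ones-insertAt xs g (s≤s (s≤s _)) = go xs g
  where
  go : ∀ {v} xs g → ones (insertAt (2 + v) xs g) ≡ ones xs
  go [] g = refl
  go (suc zero ∷ ys) zero = refl
  go (suc zero ∷ ys) (suc g) = cong suc (go ys g)
  go (zero ∷ ys) g = go ys g
  go (suc (suc y) ∷ ys) g = go ys g

others-insertAt : ∀ {v} xs g → 2 ≤ v → others (insertAt v xs g) ≡ suc (others xs)
others-insertAt xs g (s≤s (s≤s _)) = go xs g
  where
  go : ∀ {v} xs g → others (insertAt (2 + v) xs g) ≡ suc (others xs)
  go [] g = refl
  go (suc zero ∷ ys) zero = refl
  go (suc zero ∷ ys) (suc g) = go ys g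
  go (zero ∷ ys) g = cong suc (go ys g)
  go (suc (suc y) ∷ ys) g = cong suc (go ys g)

ones-duplicate : ∀ {v} xs → 2 ≤ v → ones (duplicate v xs) ≡ ones xs
ones-duplicate xs (s≤s (s≤s _)) = go xs
  where
  go : ∀ {v} xs → ones (duplicate (2 + v) xs) ≡ ones xs
  go [] = refl
  go {v} (y ∷ ys) with 2 + v ≟ y
  ... | yes refl = refl
  go (suc zero ∷ ys) | no _ = cong suc (go ys)
  go (zero ∷ ys) | no _ = go ys
  go (suc (suc y) ∷ ys) | no _ = go ys

others-duplicate : ∀ {v} xs → 2 ≤ v → v ∈ xs → others (duplicate v xs) ≡ suc (others xs)
others-duplicate xs (s≤s (s≤s _)) = go xs
  where
  go : ∀ {v} xs → 2 + v ∈ xs → others (duplicate (2 + v) xs) ≡ suc (others xs)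
  go {v} (y ∷ ys) m∈ with 2 + v ≟ y
  ... | yes refl = refl
  go (y ∷ ys) (here e) | no ne = ⊥-elim (ne e)
  go (suc zero ∷ ys) (there m∈) | no _ = go ys m∈
  go (zero ∷ ys) (there m∈) | no _ = cong suc (go ys m∈)
  go (suc (suc y) ∷ ys) (there m∈) | no _ = cong suc (go ys m∈)

ones-remove : ∀ {v} xs → 2 ≤ v → ones (remove v xs) ≡ ones xs
ones-remove xs (s≤s (s≤s _)) = go xs
  where
  go : ∀ {v} xs → ones (remove (2 + v) xs) ≡ ones xs
  go [] = refl
  go {v} (y ∷ ys) with 2 + v ≟ y
  ... | yes refl = refl
  go (suc zero ∷ ys) | no _ = cong suc (go ys)
  go (zero ∷ ys) | no _ = go ys
  go (suc (suc y) ∷ ys) | no _ = go ys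

others-remove : ∀ {v} xs → 2 ≤ v → v ∈ xs → suc (others (remove v xs)) ≡ others xs
others-remove xs (s≤s (s≤s _)) = go xs
  where
  go : ∀ {v} xs → 2 + v ∈ xs → suc (others (remove (2 + v) xs)) ≡ others xs
  go {v} (y ∷ ys) m∈ with 2 + v ≟ y
  ... | yes refl = refl
  go (y ∷ ys) (here e) | no ne = ⊥-elim (ne e)
  go (suc zero ∷ ys) (there m∈) | no _ = go ys m∈
  go (zero ∷ ys) (there m∈) | no _ = cong suc (go ys m∈)
  go (suc (suc y) ∷ ys) (there m∈) | no _ = cong suc (go ys m∈)

length≡ones+others : ∀ xs → length xs ≡ ones xs + others xs
length≡ones+others [] = refl
length≡ones+others (suc zero ∷ ys) = cong suc (length≡ones+others ys)
length≡ones+others (zero ∷ ys) = trans (cong suc (length≡ones+others ys)) (sym (+-suc (ones ys) (others ys)))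
length≡ones+others (suc (suc y) ∷ ys) = trans (cong suc (length≡ones+others ys)) (sym (+-suc (ones ys) (others ys)))

others>0⇒large : ∀ p xs → 1 ≤ p → RiseOrReset p xs → 0 < others xs → Σ ℕ λ w → w ∈ xs × 2 ≤ w
others>0⇒large p (suc zero ∷ ys) 1≤p (a , rise) lt =
  let (w , w∈ , le) = others>0⇒large 1 ys ≤-refl rise lt in w , there w∈ , le
others>0⇒large p (zero ∷ ys) 1≤p (inj₁ () , rise) lt
others>0⇒large (suc p) (zero ∷ ys) 1≤p (inj₂ () , rise) lt
others>0⇒large p (suc (suc y) ∷ ys) 1≤p (a , rise) lt = suc (suc y) , here refl , s≤s (s≤s z≤n)

large⇒others>0 : ∀ w xs → w ∈ xs → 2 ≤ w → 0 < others xs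
large⇒others>0 w (suc zero ∷ ys) (here refl) (s≤s ())
large⇒others>0 w (suc zero ∷ ys) (there p) le = large⇒others>0 w ys p le
large⇒others>0 w (zero ∷ ys) _ _ = s≤s z≤n
large⇒others>0 w (suc (suc y) ∷ ys) _ _ = s≤s z≤n

others≡0⇒replicate : ∀ p xs → 1 ≤ p → RiseOrReset p xs → others xs ≡ 0 → xs ≡ replicate (ones xs) 1
others≡0⇒replicate p [] _ _ _ = refl
others≡0⇒replicate p (suc zero ∷ ys) _ (_ , rise) e = cong (1 ∷_) (others≡0⇒replicate 1 ys ≤-refl rise e)
others≡0⇒replicate p (zero ∷ ys) 1≤p (inj₁ () , rise) e
others≡0⇒replicate (suc p) (zero ∷ ys) 1≤p (inj₂ () , rise) e

∈⇒≤maxW : ∀ {v} xs → v ∈ xs → v ≤ maxW xs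
∈⇒≤maxW (y ∷ ys) (here refl) = m≤m⊔n y (maxW ys)
∈⇒≤maxW (y ∷ ys) (there p) = ≤-trans (∈⇒≤maxW ys p) (m≤n⊔m y (maxW ys))

maxW≤ : ∀ m xs → Below m xs → maxW xs ≤ m
maxW≤ m [] _ = z≤n
maxW≤ m (y ∷ ys) bound = ⊔-lub (bound y (here refl)) (maxW≤ m ys (Below-∷ bound))

peak : Word → ℕ
peak ys = maxW (1 ∷ ys)

peak-Tail : ∀ {m xs} → Tail m xs → peak xs ≡ m
peak-Tail {m} {xs} (mkTail 1≤m _ _ bound cover) =
  ≤-antisym (maxW≤ m (1 ∷ xs) bound′) (∈⇒≤maxW (1 ∷ xs) (cover m 1≤m ≤-refl))
  where
  bound′ : Below m (1 ∷ xs)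
  bound′ w (here refl) = 1≤m
  bound′ w (there p) = bound w p

newMaxima : Word → List Word
newMaxima ys = applyUpTo (insertAt (suc (peak ys)) ys) (suc (ones ys))

-- The tails with r + 1 letters other than 1 whose parent is ys (which has r of them).
extensions : ℕ → Word → List Word
extensions zero    ys = newMaxima ys
extensions (suc r) ys = duplicate (peak ys) ys ∷ newMaxima ys

tails : ℕ → ℕ → List Word
tails a zero    = replicate a 1 ∷ []
tails a (suc r) = concatMap (extensions r) (tails a r)

parent : Word → Word
parent xs = remove (peak xs) xs

record ExtensionOf (ys : Word) (r : ℕ) (xs : Word) : Set where
  field
    isTail  : Σ ℕ λ m → Tail m xs
    ones≡   : ones xs ≡ ones ys
    others≡ : others xs ≡ suc r
    parent≡ : parent xs ≡ ys

Tail-replicate : ∀ a → Tail 1 (replicate a 1) × ones (replicate a 1) ≡ a × others (replicate a 1) ≡ 0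
Tail-replicate zero    = mkTail (s≤s z≤n) tt tt (λ _ ()) covers , refl , refl
  where
  covers : Covers 1 []
  covers (suc zero)    _ _         = here refl
  covers (suc (suc j)) _ (s≤s ())
Tail-replicate (suc a) with Tail-replicate a
... | mkTail _ rise blocks bound cover , ones≡a , others≡0 =
  mkTail (s≤s z≤n) (inj₁ refl , rise) ((λ { (s≤s ()) }) , blocks) below covers , cong suc ones≡a , others≡0
  where
  below : Below 1 (replicate (suc a) 1)
  below w (here refl) = s≤s z≤n
  below w (there p)   = bound w p
  covers : Covers 1 (replicate (suc a) 1)
  covers (suc zero)    _ _         = here refl
  covers (suc (suc j)) _ (s≤s ())

Tail-2≤ : ∀ {m xs} → Tail m xs → 0 < others xs → 2 ≤ m
Tail-2≤ {m} {xs} (mkTail _ rise _ bound _) others>0 with others>0⇒large 1 xs ≤-refl rise others>0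
... | w , w∈ , 2≤w = ≤-trans 2≤w (bound w w∈)

insertAt-extends : ∀ m ys g → Tail m ys → ExtensionOf ys (others ys) (insertAt (suc m) ys g)
insertAt-extends m ys g gd = record
  { isTail  = suc m , gd′
  ; ones≡   = ones-insertAt ys g 2≤
  ; others≡ = others-insertAt ys g 2≤
  ; parent≡ = trans (cong (λ v → remove v (insertAt (suc m) ys g)) (peak-Tail gd′))
                    (remove-insertAt (suc m) ys g (λ m+1∈ → 1+n≰n (Tail.below gd _ m+1∈)))
  }
  where
  gd′ = Tail-insertAt g gd
  2≤ : 2 ≤ suc m
  2≤ = s≤s (Tail.1≤m gd)

duplicate-extends : ∀ m ys → Tail m ys → 2 ≤ m → ExtensionOf ys (others ys) (duplicate m ys)
duplicate-extends m ys gd 2≤m = record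
  { isTail  = m , proj₂ (Tail-duplicate gd 2≤m)
  ; ones≡   = ones-duplicate ys 2≤m
  ; others≡ = others-duplicate ys 2≤m (proj₁ (Tail-duplicate gd 2≤m))
  ; parent≡ = trans (cong (λ v → remove v (duplicate m ys)) (peak-Tail (proj₂ (Tail-duplicate gd 2≤m))))
                    (remove-duplicate m ys)
  }

∈-newMaxima⁻ : ∀ {x} ys → x ∈ newMaxima ys → Σ ℕ λ g → g < suc (ones ys) × x ≡ insertAt (suc (peak ys)) ys g
∈-newMaxima⁻ ys = ∈-applyUpTo⁻ (insertAt (suc (peak ys)) ys)

∈-newMaxima⇒ExtensionOf : ∀ m ys x → Tail m ys → x ∈ newMaxima ys → ExtensionOf ys (others ys) x
∈-newMaxima⇒ExtensionOf m ys x gd x∈ with ∈-newMaxima⁻ ys x∈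
... | g , _ , refl =
  subst (λ v → ExtensionOf ys (others ys) (insertAt (suc v) ys g)) (sym (peak-Tail gd)) (insertAt-extends m ys g gd)

∈-extensions⇒ExtensionOf : ∀ r m ys x → Tail m ys → others ys ≡ r → x ∈ extensions r ys → ExtensionOf ys r x
∈-extensions⇒ExtensionOf zero m ys x gd others≡ x∈ =
  subst (λ r → ExtensionOf ys r x) others≡ (∈-newMaxima⇒ExtensionOf m ys x gd x∈)
∈-extensions⇒ExtensionOf (suc r) m ys x gd others≡ (there x∈) =
  subst (λ r → ExtensionOf ys r x) others≡ (∈-newMaxima⇒ExtensionOf m ys x gd x∈)
∈-extensions⇒ExtensionOf (suc r) m ys x gd others≡ (here refl) =
  subst₂ (λ v r → ExtensionOf ys r (duplicate v ys)) (sym (peak-Tail gd)) others≡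
         (duplicate-extends m ys gd (Tail-2≤ gd (subst (0 <_) (sym others≡) z<s)))

∈-tails⇒Tail : ∀ a r x → x ∈ tails a r → Σ ℕ (λ m → Tail m x) × ones x ≡ a × others x ≡ r
∈-tails⇒Tail a zero    x (here refl) = let (gd , ones≡ , others≡) = Tail-replicate a in (1 , gd) , ones≡ , others≡
∈-tails⇒Tail a (suc r) x x∈ with find (∈-concatMap⁻ (extensions r) x∈)
... | ys , ys∈ , x∈ext with ∈-tails⇒Tail a r ys ys∈
... | (m , gd) , ones≡a , others≡r =
  ExtensionOf.isTail ext , trans (ExtensionOf.ones≡ ext) ones≡a , ExtensionOf.others≡ ext
  where
  ext = ∈-extensions⇒ExtensionOf r m ys x gd others≡r x∈ext

-- A tail with maximum m ≥ 2 is recovered from the result of removing one copy of m, either by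
-- duplicating m (if another copy remains) or by inserting m as a new maximum.
∈-extensions-remove : ∀ {m xs} → Tail m xs → 2 ≤ m →
                      Σ ℕ (λ m′ → Tail m′ (remove m xs)) × xs ∈ extensions (others (remove m xs)) (remove m xs)
∈-extensions-remove {m} {xs} gd 2≤m with m ∈? remove m xs
... | yes m∈ys = (m , gd′) , subst (_∈ extensions (others ys) ys) xs≡ (duplicate∈extensions (large⇒others>0 m ys m∈ys 2≤m))
  where
  ys = remove m xs
  gd′ = Tail-remove-repeated gd m∈ys
  duplicate∈extensions : ∀ {r} → 0 < r → duplicate (peak ys) ys ∈ extensions r ys
  duplicate∈extensions {suc r} _ = here refl
  xs≡ : duplicate (peak ys) ys ≡ xs
  xs≡ = trans (cong (λ v → duplicate v ys) (peak-Tail gd′)) (duplicate-remove m xs 2≤m (Tail.contiguous gd) m∈ys)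
∈-extensions-remove {suc k} {xs} gd (s≤s 1≤k) | no m∉ys =
  (k , gd′) , newMaxima⊆extensions {others ys} (subst (_∈ newMaxima ys) xs≡ g∈)
  where
  ys = remove (suc k) xs
  gd′ = Tail-remove-unique gd 1≤k m∉ys
  newMaxima⊆extensions : ∀ {r x} → x ∈ newMaxima ys → x ∈ extensions r ys
  newMaxima⊆extensions {zero}  x∈ = x∈
  newMaxima⊆extensions {suc r} x∈ = there x∈
  g∈ : insertAt (suc (peak ys)) ys (onesBefore (suc k) xs) ∈ newMaxima ys
  g∈ = ∈-applyUpTo⁺ (insertAt (suc (peak ys)) ys) (s≤s (onesBefore≤ones (suc k) xs (2≤⇒≢1 (s≤s 1≤k))))
  xs≡ : insertAt (suc (peak ys)) ys (onesBefore (suc k) xs) ≡ xs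
  xs≡ = trans (cong (λ v → insertAt (suc v) ys (onesBefore (suc k) xs)) (peak-Tail gd′))
              (insertAt-remove 1 (suc k) xs (s≤s 1≤k) (Tail.riseOrReset gd) (Tail.below gd)
                               (proj₁ (Tail-duplicate gd (s≤s 1≤k))) m∉ys)

Tail⇒∈-tails : ∀ r m xs → Tail m xs → others xs ≡ r → xs ∈ tails (ones xs) r
Tail⇒∈-tails zero    m xs gd others≡0 = here (others≡0⇒replicate 1 xs ≤-refl (Tail.riseOrReset gd) others≡0)
Tail⇒∈-tails (suc r) m xs gd others≡ = subst (λ a → xs ∈ tails a (suc r)) (ones-remove xs 2≤m)
  (∈-concatMap⁺ (extensions r) (lose (Tail⇒∈-tails r m′ ys gd′ others-ys) (subst (λ r → xs ∈ extensions r ys) others-ys xs∈)))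
  where
  2≤m : 2 ≤ m
  2≤m = Tail-2≤ gd (subst (0 <_) (sym others≡) z<s)
  ys = remove m xs
  others-ys : others ys ≡ r
  others-ys = suc-injective (trans (others-remove xs 2≤m (proj₁ (Tail-duplicate gd 2≤m))) others≡)
  m′  = proj₁ (proj₁ (∈-extensions-remove gd 2≤m))
  gd′ = proj₂ (proj₁ (∈-extensions-remove gd 2≤m))
  xs∈ = proj₂ (∈-extensions-remove gd 2≤m)

newMaxima-unique : ∀ m ys → Tail m ys → Unique (newMaxima ys)
newMaxima-unique m ys gd = UP.applyUpTo⁺₁ _ (suc (ones ys)) insertAt-injective
  where
  v∉ : suc (peak ys) ∉ ys
  v∉ v∈ = 1+n≰n (subst (λ z → suc z ≤ m) (peak-Tail gd) (Tail.below gd _ v∈))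
  2≤ : 2 ≤ suc (peak ys)
  2≤ = s≤s (subst (1 ≤_) (sym (peak-Tail gd)) (Tail.1≤m gd))
  insertAt-injective : ∀ {i j} → i < j → j < suc (ones ys) → insertAt (suc (peak ys)) ys i ≢ insertAt (suc (peak ys)) ys j
  insertAt-injective {i} {j} i<j (s≤s j≤) eq = <-irrefl (begin
    i                                                     ≡⟨ onesBefore-insertAt _ ys i 2≤ v∉ (≤-trans (<⇒≤ i<j) j≤) ⟨
    onesBefore (suc (peak ys)) (insertAt (suc (peak ys)) ys i) ≡⟨ cong (onesBefore (suc (peak ys))) eq ⟩
    onesBefore (suc (peak ys)) (insertAt (suc (peak ys)) ys j) ≡⟨ onesBefore-insertAt _ ys j 2≤ v∉ j≤ ⟩
    j                                                     ∎) i<j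

extensions-unique : ∀ r m ys → Tail m ys → others ys ≡ r → Unique (extensions r ys)
extensions-unique zero    m ys gd _       = newMaxima-unique m ys gd
extensions-unique (suc r) m ys gd others≡ = All.tabulate duplicate≢newMax ∷ newMaxima-unique m ys gd
  where
  2≤m : 2 ≤ m
  2≤m = Tail-2≤ gd (subst (0 <_) (sym others≡) z<s)
  -- the two kinds of extension differ in their maximum
  duplicate≢newMax : ∀ {x} → x ∈ newMaxima ys → duplicate (peak ys) ys ≢ x
  duplicate≢newMax x∈ eq with ∈-newMaxima⁻ ys x∈
  ... | g , _ , refl = 1+n≰n (≤-reflexive (sym (begin
    m                                    ≡⟨ peak-Tail (proj₂ (Tail-duplicate gd 2≤m)) ⟨
    peak (duplicate m ys)                ≡⟨ cong peak (subst (λ v → duplicate v ys ≡ insertAt (suc v) ys g) (peak-Tail gd) eq) ⟩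
    peak (insertAt (suc m) ys g)         ≡⟨ peak-Tail (Tail-insertAt g gd) ⟩
    suc m                                ∎)))

tails-unique : ∀ a r → Unique (tails a r)
tails-unique a zero    = All.[] ∷ []
tails-unique a (suc r) = Unique-concatMap (extensions r) parent (tails a r) (tails-unique a r)
  (λ ys ys∈ → let ((m , gd) , _ , others≡) = ∈-tails⇒Tail a r ys ys∈ in extensions-unique r m ys gd others≡)
  (λ ys x ys∈ x∈ → let ((m , gd) , _ , others≡) = ∈-tails⇒Tail a r ys ys∈ in
                    ExtensionOf.parent≡ (∈-extensions⇒ExtensionOf r m ys x gd others≡ x∈))

length-tails : ∀ a r → length (tails a r) ≡ coeff (suc a) r
length-tails a zero          = refl
length-tails a (suc zero)    = begin
  length (concatMap (extensions 0) (tails a 0)) ≡⟨ length-concatMap-const (extensions 0) (tails a 0) (suc a) length-newMaxima ⟩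
  1 * suc a                                     ≡⟨ *-comm 1 (suc a) ⟩
  suc a * 1                                     ∎
  where
  length-newMaxima : ∀ ys → ys ∈ tails a 0 → length (newMaxima ys) ≡ suc a
  length-newMaxima ys ys∈ =
    trans (length-applyUpTo (insertAt (suc (peak ys)) ys) (suc (ones ys))) (cong suc (proj₁ (proj₂ (∈-tails⇒Tail a 0 ys ys∈))))
length-tails a (suc (suc r)) = begin
  length (concatMap (extensions (suc r)) (tails a (suc r)))
    ≡⟨ length-concatMap-const (extensions (suc r)) (tails a (suc r)) (2 + a) length-extensions ⟩
  length (tails a (suc r)) * (2 + a)
    ≡⟨ cong (_* (2 + a)) (length-tails a (suc r)) ⟩
  suc a * (2 + a) ^ r * (2 + a)
    ≡⟨ regroup a ((2 + a) ^ r) ⟩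
  suc a * ((2 + a) * (2 + a) ^ r) ∎
  where
  length-extensions : ∀ ys → ys ∈ tails a (suc r) → length (extensions (suc r) ys) ≡ 2 + a
  length-extensions ys ys∈ =
    cong suc (trans (length-applyUpTo (insertAt (suc (peak ys)) ys) (suc (ones ys))) (cong suc (proj₁ (proj₂ (∈-tails⇒Tail a (suc r) ys ys∈)))))
  regroup : ∀ a x → (1 + a) * x * (2 + a) ≡ (1 + a) * ((2 + a) * x)
  regroup = solve-∀

-- at x i is the letter at position i, counting from 0; it is 0 past the end of x.
at : Word → ℕ → ℕ
at [] _ = 0
at (y ∷ ys) zero = y
at (y ∷ ys) (suc i) = at ys i

lookup≡at : ∀ x (i : Fin (length x)) → lookup x i ≡ at x (toℕ i)
lookup≡at (y ∷ ys) F.zero = refl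
lookup≡at (y ∷ ys) (F.suc i) = lookup≡at ys i

lookup-fromℕ< : ∀ (x : Word) {t} (p : t < length x) → lookup x (fromℕ< p) ≡ at x t
lookup-fromℕ< x p = trans (lookup≡at x (fromℕ< p)) (cong (at x) (toℕ-fromℕ< p))

at∈ : ∀ x i → i < length x → at x i ∈ x
at∈ (y ∷ ys) zero _ = here refl
at∈ (y ∷ ys) (suc i) (s≤s p) = there (at∈ ys i p)

lookup∈ : ∀ (x : Word) i → lookup x i ∈ x
lookup∈ x i = subst (_∈ x) (sym (lookup≡at x i)) (at∈ x (toℕ i) (toℕ<n i))

∈⇒at : ∀ {v} x → v ∈ x → Σ ℕ λ i → i < length x × at x i ≡ v
∈⇒at (y ∷ ys) (here e) = 0 , s≤s z≤n , sym e
∈⇒at (y ∷ ys) (there p) = let (i , lt , e) = ∈⇒at ys p in suc i , s≤s lt , e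

least-witness : ∀ (P : ℕ → Set) → (∀ k → Dec (P k)) → ∀ n →
       (∀ j → j < n → ¬ P j) ⊎ Σ ℕ (λ k → k < n × P k × (∀ j → j < k → ¬ P j))
least-witness P P? zero = inj₁ (λ j ())
least-witness P P? (suc n) with least-witness P P? n
... | inj₂ (k , k<n , pk , mn) = inj₂ (k , m<n⇒m<1+n k<n , pk , mn)
... | inj₁ none with P? n
... | yes pn = inj₂ (n , n<1+n n , pn , none)
... | no ¬pn = inj₁ (λ j j< → up-to-n j (m≤n⇒m<n∨m≡n (≤-pred j<)))
  where
  up-to-n : ∀ j → j < n ⊎ j ≡ n → ¬ P j
  up-to-n j (inj₁ j<n)  = none j j<n
  up-to-n j (inj₂ refl) = ¬pn

RiseOrResetAt : Word → Set
RiseOrResetAt x = ∀ t → suc t < length x → at x (suc t) ≡ 1 ⊎ at x t ≤ at x (suc t)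

RiseOrReset⇒At : ∀ p xs → RiseOrReset p xs → RiseOrResetAt (p ∷ xs)
RiseOrReset⇒At p [] _ t (s≤s ())
RiseOrReset⇒At p (y ∷ ys) (a , rise) zero _ = a
RiseOrReset⇒At p (y ∷ ys) (a , rise) (suc t) (s≤s lt) = RiseOrReset⇒At y ys rise t lt

At⇒RiseOrReset : ∀ p xs → RiseOrResetAt (p ∷ xs) → RiseOrReset p xs
At⇒RiseOrReset p [] _ = tt
At⇒RiseOrReset p (y ∷ ys) h = h 0 (s≤s (s≤s z≤n)) , At⇒RiseOrReset y ys (λ t lt → h (suc t) (s≤s lt))

RiseOrReset⇒positive : ∀ p xs → 1 ≤ p → RiseOrReset p xs → ∀ v → v ∈ xs → 1 ≤ v
RiseOrReset⇒positive p (y ∷ ys) 1≤p (a , rise) v (here refl) with a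
... | inj₁ refl = ≤-refl
... | inj₂ le = ≤-trans 1≤p le
RiseOrReset⇒positive p (y ∷ ys) 1≤p (a , rise) v (there q) =
  RiseOrReset⇒positive y ys (RiseOrReset⇒positive p (y ∷ ys) 1≤p (a , rise) y (here refl)) rise v q

Contiguous-between : ∀ x → Contiguous x → ∀ q r s → q < r → r < s → s < length x →
                     at x q ≡ at x s → 2 ≤ at x q → at x r ≡ at x q
Contiguous-between (y ∷ ys) (block , blocks) zero (suc zero) (suc s) _ _ (s≤s s<) e 2≤
  with block 2≤ (subst (_∈ ys) (sym e) (at∈ ys s s<))
... | zs , refl = refl
Contiguous-between (y ∷ ys) (block , blocks) zero (suc (suc r)) (suc s) _ (s≤s r<s) (s≤s s<) e 2≤
  with block 2≤ (subst (_∈ ys) (sym e) (at∈ ys s s<))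
... | zs , refl = Contiguous-between (y ∷ zs) blocks zero (suc r) s (s≤s z≤n) r<s s< e 2≤
Contiguous-between (y ∷ ys) (block , blocks) (suc q) (suc r) (suc s) (s≤s q<r) (s≤s r<s) (s≤s s<) e 2≤ =
  Contiguous-between ys blocks q r s q<r r<s s< e 2≤

BlockAt : Word → Set
BlockAt x = ∀ q s → q < s → s < length x → at x q ≡ at x s → 2 ≤ at x q → at x (suc q) ≡ at x q

BlockAt-head : ∀ y ys → BlockAt (y ∷ ys) → 2 ≤ y → y ∈ ys → HeadIs y ys
BlockAt-head y (z ∷ zs) blockAt 2≤ y∈ with ∈⇒at (z ∷ zs) y∈
... | s , s< , e = zs , cong (_∷ zs) (blockAt 0 (suc s) (s≤s z≤n) (s≤s s<) (sym e) 2≤)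

BlockAt⇒Contiguous : ∀ x → BlockAt x → Contiguous x
BlockAt⇒Contiguous [] _ = tt
BlockAt⇒Contiguous (y ∷ ys) blockAt =
  BlockAt-head y ys blockAt , BlockAt⇒Contiguous ys (λ q s q<s s< e 2≤ → blockAt (suc q) (suc s) (s≤s q<s) (s≤s s<) e 2≤)

LocalStep : Word → Set
LocalStep x = ∀ j → suc j < length x →
  at x (suc j) ≡ 1 ⊎ at x (suc j) ≡ at x j ⊎ (at x j < at x (suc j) × (∀ k → k < suc j → ¬ at x k ≡ at x (suc j)))

LocalStep⇒BlockAt : ∀ x → LocalStep x → BlockAt x
LocalStep⇒BlockAt x step q (suc j) q<s s< e 2≤ with step j s<
... | inj₁ e1 = ⊥-elim (1+n≰n (subst (2 ≤_) (trans e e1) 2≤))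
... | inj₂ (inj₂ (_ , new)) = ⊥-elim (new q q<s e)
... | inj₂ (inj₁ e2) with m≤n⇒m<n∨m≡n (≤-pred q<s)
... | inj₂ refl = sym e
... | inj₁ q<j = LocalStep⇒BlockAt x step q j q<j (<-trans (n<1+n j) s<) (trans e e2) 2≤

LocalStep⇒RiseOrReset : ∀ p xs → LocalStep (p ∷ xs) → RiseOrReset p xs
LocalStep⇒RiseOrReset p xs step = At⇒RiseOrReset p xs (λ t t< → weaken (step t t<))
  where
  weaken : ∀ {a b} {C : Set} → b ≡ 1 ⊎ b ≡ a ⊎ (a < b × C) → b ≡ 1 ⊎ a ≤ b
  weaken (inj₁ b≡1)              = inj₁ b≡1
  weaken (inj₂ (inj₁ b≡a))       = inj₂ (≤-reflexive (sym b≡a))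
  weaken (inj₂ (inj₂ (a<b , _))) = inj₂ (<⇒≤ a<b)

p1232 : Word
p1232 = 1 ∷ 2 ∷ 3 ∷ 2 ∷ []

module Occurrence (x : Word) (p q r s : ℕ) (p<q : p < q) (q<r : q < r) (r<s : r < s) (s< : s < length x)
                  (a<b : at x p < at x q) (b<c : at x q < at x r) (d≡b : at x s ≡ at x q) where

  value : ℕ → ℕ
  value 1 = at x p
  value 2 = at x q
  value _ = at x r

  value-mono : ∀ u w → 1 ≤ u → w ≤ 3 → u < w → value u < value w
  value-mono 1 2 _ _ _ = a<b
  value-mono 1 3 _ _ _ = <-trans a<b b<c
  value-mono 2 3 _ _ _ = b<c
  value-mono 1 (suc (suc (suc (suc w)))) _ (s≤s (s≤s (s≤s ()))) _
  value-mono 2 (suc (suc (suc (suc w)))) _ (s≤s (s≤s (s≤s ()))) _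
  value-mono 1 1 _ _ (s≤s ())
  value-mono 1 0 _ _ ()
  value-mono 2 0 _ _ ()
  value-mono 2 1 _ _ (s≤s ())
  value-mono 2 2 _ _ (s≤s (s≤s ()))
  value-mono (suc (suc (suc u))) w _ w≤3 lt = ⊥-elim (1+n≰n (≤-trans (s≤s (s≤s (s≤s (s≤s z≤n)))) (≤-trans lt w≤3)))

  value-iff : ∀ u w → 1 ≤ u → u ≤ 3 → 1 ≤ w → w ≤ 3 → ((value u < value w) ⇔ (u < w)) × ((value u ≡ value w) ⇔ (u ≡ w))
  value-iff u w 1≤u u≤3 1≤w w≤3 = mk⇔ reflect-< (value-mono u w 1≤u w≤3) , mk⇔ reflect-≡ (cong value)
    where
    reflect-< : value u < value w → u < w
    reflect-< lt with <-cmp u w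
    ... | tri< a _ _ = a
    ... | tri≈ _ refl _ = ⊥-elim (<-irrefl refl lt)
    ... | tri> _ _ c = ⊥-elim (<-asym lt (value-mono w u 1≤w u≤3 c))
    reflect-≡ : value u ≡ value w → u ≡ w
    reflect-≡ e with <-cmp u w
    ... | tri< a _ _ = ⊥-elim (<-irrefl e (value-mono u w 1≤u w≤3 a))
    ... | tri≈ _ b _ = b
    ... | tri> _ _ c = ⊥-elim (<-irrefl (sym e) (value-mono w u 1≤w u≤3 c))

  position : ℕ → ℕ
  position 0 = p
  position 1 = q
  position 2 = r
  position _ = s

  position-mono : ∀ u w → w ≤ 3 → u < w → position u < position w
  position-mono 0 1 _ _ = p<q
  position-mono 0 2 _ _ = <-trans p<q q<r
  position-mono 0 3 _ _ = <-trans p<q (<-trans q<r r<s)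
  position-mono 1 2 _ _ = q<r
  position-mono 1 3 _ _ = <-trans q<r r<s
  position-mono 2 3 _ _ = r<s
  position-mono u 0 _ ()
  position-mono 1 1 _ (s≤s ())
  position-mono 2 1 _ (s≤s ())
  position-mono 2 2 _ (s≤s (s≤s ()))
  position-mono 0 (suc (suc (suc (suc w)))) (s≤s (s≤s (s≤s ()))) _
  position-mono 1 (suc (suc (suc (suc w)))) (s≤s (s≤s (s≤s ()))) _
  position-mono 2 (suc (suc (suc (suc w)))) (s≤s (s≤s (s≤s ()))) _
  position-mono (suc (suc (suc u))) w w≤3 lt = ⊥-elim (1+n≰n (≤-trans (s≤s (s≤s (s≤s (s≤s z≤n)))) (≤-trans lt w≤3)))

  position< : ∀ u → position u < length x
  position< 0 = <-trans p<q (<-trans q<r (<-trans r<s s<))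
  position< 1 = <-trans q<r (<-trans r<s s<)
  position< 2 = <-trans r<s s<
  position< (suc (suc (suc u))) = s<

  embedding : Fin 4 → Fin (length x)
  embedding i = fromℕ< (position< (toℕ i))

  lookup-embedding : ∀ i → lookup x (embedding i) ≡ value (lookup p1232 i)
  lookup-embedding F.zero = lookup-fromℕ< x (position< 0)
  lookup-embedding (F.suc F.zero) = lookup-fromℕ< x (position< 1)
  lookup-embedding (F.suc (F.suc F.zero)) = lookup-fromℕ< x (position< 2)
  lookup-embedding (F.suc (F.suc (F.suc F.zero))) = trans (lookup-fromℕ< x (position< 3)) d≡b

  p1232-range : ∀ i → 1 ≤ lookup p1232 i × lookup p1232 i ≤ 3
  p1232-range F.zero = s≤s z≤n , s≤s z≤n
  p1232-range (F.suc F.zero) = s≤s z≤n , s≤s (s≤s z≤n)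
  p1232-range (F.suc (F.suc F.zero)) = s≤s z≤n , s≤s (s≤s (s≤s z≤n))
  p1232-range (F.suc (F.suc (F.suc F.zero))) = s≤s z≤n , s≤s (s≤s z≤n)

  contains : Contains x p1232
  contains = embedding , mono , iffs
    where
    mono : ∀ a b → toℕ a < toℕ b → toℕ (embedding a) < toℕ (embedding b)
    mono a b lt = subst₂ _<_ (sym (toℕ-fromℕ< (position< (toℕ a)))) (sym (toℕ-fromℕ< (position< (toℕ b))))
      (position-mono (toℕ a) (toℕ b) (≤-pred (toℕ<n b)) lt)
    iffs : ∀ a b → ((lookup x (embedding a) < lookup x (embedding b)) ⇔ (lookup p1232 a < lookup p1232 b))
                 × ((lookup x (embedding a) ≡ lookup x (embedding b)) ⇔ (lookup p1232 a ≡ lookup p1232 b))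
    iffs a b = subst₂ (λ u w → ((u < w) ⇔ (lookup p1232 a < lookup p1232 b)) × ((u ≡ w) ⇔ (lookup p1232 a ≡ lookup p1232 b)))
      (sym (lookup-embedding a)) (sym (lookup-embedding b))
      (value-iff (lookup p1232 a) (lookup p1232 b) (proj₁ (p1232-range a)) (proj₂ (p1232-range a)) (proj₁ (p1232-range b)) (proj₂ (p1232-range b)))

module _ {m xs} (gd : Tail m xs) where
  open Tail gd

  private
    x : Word
    x = 1 ∷ xs

    positive : ∀ v → v ∈ x → 1 ≤ v
    positive v (here refl) = ≤-refl
    positive v (there v∈)  = RiseOrReset⇒positive 1 xs ≤-refl riseOrReset v v∈

    at-positive : ∀ t → t < length x → 1 ≤ at x t
    at-positive t t< = positive _ (at∈ x t t<)

    contiguous′ : Contiguous x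
    contiguous′ = (λ { (s≤s ()) }) , contiguous

    leftmost : ∀ i v → lookup x i ≡ v → (∀ j → toℕ j < toℕ i → lookup x j ≢ v) → LeftmostCopy x i v
    leftmost i v refl first = positive _ (lookup∈ x i) , ∈⇒≤maxW x (lookup∈ x i) , refl , first

  Tail⇒IsCayley : IsCayley (1 ∷ xs)
  Tail⇒IsCayley = positive , λ j 1≤j j≤max → covers j 1≤j (subst (j ≤_) (peak-Tail gd) j≤max)

  -- An earlier copy of an ascent top x_t lies before x_{t−1}; as x_t ≥ 2 its copies form a block,
  -- forcing x_{t−1} = x_t.
  Tail⇒AscentTop⇒LeftmostCopy : ∀ i v → AscentTop (1 ∷ xs) i v → LeftmostCopy (1 ∷ xs) i v
  Tail⇒AscentTop⇒LeftmostCopy i v (e , inj₁ i≡0) =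
    leftmost i v e (λ k k<i → ⊥-elim (n≮0 (subst (toℕ k <_) i≡0 k<i)))
  Tail⇒AscentTop⇒LeftmostCopy i v (e , inj₂ (j , j+1≡i , xj<xi)) = leftmost i v e no-earlier-copy
    where
    t = toℕ i
    jj = toℕ j
    rise : at x jj < at x t
    rise = subst₂ _<_ (lookup≡at x j) (lookup≡at x i) xj<xi
    no-earlier-copy : ∀ k → toℕ k < t → lookup x k ≢ v
    no-earlier-copy k k<t xk≡v with m≤n⇒m<n∨m≡n (≤-pred (subst (toℕ k <_) (sym j+1≡i) k<t))
    ... | inj₂ k≡j = <-irrefl (trans (cong (at x) (sym k≡j)) xk≡xt) rise
      where
      xk≡xt : at x (toℕ k) ≡ at x t
      xk≡xt = trans (sym (lookup≡at x k)) (trans xk≡v (trans (sym e) (lookup≡at x i)))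
    ... | inj₁ k<j = <-irrefl (trans block xk≡xt) rise
      where
      xk≡xt : at x (toℕ k) ≡ at x t
      xk≡xt = trans (sym (lookup≡at x k)) (trans xk≡v (trans (sym e) (lookup≡at x i)))
      2≤xk : 2 ≤ at x (toℕ k)
      2≤xk = subst (2 ≤_) (sym xk≡xt) (≤-trans (s≤s (at-positive jj (toℕ<n j))) rise)
      block : at x jj ≡ at x (toℕ k)
      block = Contiguous-between x contiguous′ (toℕ k) jj t k<j (subst (jj <_) j+1≡i (n<1+n jj)) (toℕ<n i) xk≡xt 2≤xk

  -- A leftmost copy is not a reset to 1, so it is a weak rise, and a strict one since otherwise
  -- x_{t−1} is an earlier copy.
  Tail⇒LeftmostCopy⇒AscentTop : ∀ i v → LeftmostCopy (1 ∷ xs) i v → AscentTop (1 ∷ xs) i v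
  Tail⇒LeftmostCopy⇒AscentTop i v (_ , _ , e , first) = by-position (toℕ i) refl
    where
    by-position : ∀ t → toℕ i ≡ t → AscentTop x i v
    by-position zero    i≡0 = e , inj₁ i≡0
    by-position (suc j) i≡t = step (RiseOrReset⇒At 1 xs riseOrReset j t<)
      where
      t< : suc j < length x
      t< = subst (_< length x) i≡t (toℕ<n i)
      j< : j < length x
      j< = <-trans (n<1+n j) t<
      xt≡v : at x (suc j) ≡ v
      xt≡v = trans (sym (cong (at x) i≡t)) (trans (sym (lookup≡at x i)) e)
      step : at x (suc j) ≡ 1 ⊎ at x j ≤ at x (suc j) → AscentTop x i v
      step (inj₁ xt≡1) = ⊥-elim (first F.zero (subst (0 <_) (sym i≡t) z<s) (trans (sym xt≡1) xt≡v))
      step (inj₂ xj≤xt) = e , inj₂ (fromℕ< j< , trans (cong suc (toℕ-fromℕ< j<)) (sym i≡t) ,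
                                    subst₂ _<_ (sym (lookup-fromℕ< x j<)) (trans xt≡v (sym e)) (≤∧≢⇒< xj≤xt xj≢xt))
        where
        xj≢xt : at x j ≢ at x (suc j)
        xj≢xt eq = first (fromℕ< j<) (subst (_< toℕ i) (sym (toℕ-fromℕ< j<)) (subst (j <_) (sym i≡t) (n<1+n j)))
                         (trans (lookup-fromℕ< x j<) (trans eq xt≡v))

  -- In an occurrence a b c b of 1232, b ≥ 2 recurs after c ≠ b, breaking the block of b.
  Tail⇒avoids : Avoids (1 ∷ xs) p1232
  Tail⇒avoids (f , increasing , same-order) = <-irrefl (sym c≡b) b<c
    where
    pos : Fin 4 → ℕ
    pos a = toℕ (f a)
    val : ∀ a → lookup x (f a) ≡ at x (pos a)
    val a = lookup≡at x (f a)
    i0 i1 i2 i3 : Fin 4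
    i0 = F.zero
    i1 = F.suc F.zero
    i2 = F.suc (F.suc F.zero)
    i3 = F.suc (F.suc (F.suc F.zero))
    a<b : at x (pos i0) < at x (pos i1)
    a<b = subst₂ _<_ (val i0) (val i1) (Equivalence.from (proj₁ (same-order i0 i1)) (s≤s (s≤s z≤n)))
    b<c : at x (pos i1) < at x (pos i2)
    b<c = subst₂ _<_ (val i1) (val i2) (Equivalence.from (proj₁ (same-order i1 i2)) (s≤s (s≤s (s≤s z≤n))))
    b≡b : at x (pos i1) ≡ at x (pos i3)
    b≡b = trans (sym (val i1)) (trans (Equivalence.from (proj₂ (same-order i1 i3)) refl) (val i3))
    2≤b : 2 ≤ at x (pos i1)
    2≤b = ≤-trans (s≤s (at-positive (pos i0) (toℕ<n (f i0)))) a<b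
    c≡b : at x (pos i2) ≡ at x (pos i1)
    c≡b = Contiguous-between x contiguous′ (pos i1) (pos i2) (pos i3)
            (increasing i1 i2 (s≤s (s≤s z≤n))) (increasing i2 i3 (s≤s (s≤s (s≤s z≤n)))) (toℕ<n (f i3)) b≡b 2≤b

Tail⇒modasc : ∀ {m xs} → Tail m xs → IsModAsc (1 ∷ xs) × Avoids (1 ∷ xs) p1232
Tail⇒modasc gd = (Tail⇒IsCayley gd , λ i v → mk⇔ (Tail⇒AscentTop⇒LeftmostCopy gd i v) (Tail⇒LeftmostCopy⇒AscentTop gd i v))
               , Tail⇒avoids gd

module _ {x : Word} (cayley : IsCayley x) (ascent⇔leftmost : ∀ i v → AscentTop x i v ⇔ LeftmostCopy x i v)
         (avoids : Avoids x p1232) where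

  private
    positive : ∀ t → t < length x → 1 ≤ at x t
    positive t t< = proj₁ cayley _ (at∈ x t t<)

  first⇒ascent : ∀ t (t< : t < length x) → (∀ k → k < t → at x k ≢ at x t) →
                 t ≡ 0 ⊎ Σ ℕ (λ j → suc j ≡ t × at x j < at x t)
  first⇒ascent t t< first with Equivalence.from (ascent⇔leftmost (fromℕ< t<) (at x t)) leftmost
    where
    leftmost : LeftmostCopy x (fromℕ< t<) (at x t)
    leftmost = positive t t< , ∈⇒≤maxW x (at∈ x t t<) , lookup-fromℕ< x t< ,
               λ k k< xk≡xt → first (toℕ k) (subst (toℕ k <_) (toℕ-fromℕ< t<) k<) (trans (sym (lookup≡at x k)) xk≡xt)
  ... | _ , inj₁ t≡0              = inj₁ (trans (sym (toℕ-fromℕ< t<)) t≡0)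
  ... | _ , inj₂ (j , j+1≡t , lt) =
    inj₂ (toℕ j , trans j+1≡t (toℕ-fromℕ< t<) , subst₂ _<_ (lookup≡at x j) (lookup-fromℕ< x t<) lt)

  ascent⇒first : ∀ j (t< : suc j < length x) → at x j < at x (suc j) → ∀ k → k < suc j → at x k ≢ at x (suc j)
  ascent⇒first j t< rise k k< xk≡xt =
    proj₂ (proj₂ (proj₂ leftmost)) (fromℕ< k<len) (subst₂ _<_ (sym (toℕ-fromℕ< k<len)) (sym (toℕ-fromℕ< t<)) k<)
          (trans (lookup-fromℕ< x k<len) xk≡xt)
    where
    k<len : k < length x
    k<len = <-trans k< t<
    j< : j < length x
    j< = <-trans (n<1+n j) t<
    leftmost : LeftmostCopy x (fromℕ< t<) (at x (suc j))
    leftmost = Equivalence.to (ascent⇔leftmost (fromℕ< t<) (at x (suc j)))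
      (lookup-fromℕ< x t< , inj₂ (fromℕ< j< , trans (cong suc (toℕ-fromℕ< j<)) (sym (toℕ-fromℕ< t<)) ,
        subst₂ _<_ (sym (lookup-fromℕ< x j<)) (sym (lookup-fromℕ< x t<)) rise))

  -- The first 1 is a leftmost copy, hence an ascent top, and no letter lies below 1.
  head≡1 : 0 < length x → at x 0 ≡ 1
  head≡1 0<len with ∈⇒at x (proj₂ cayley 1 ≤-refl (≤-trans (positive 0 0<len) (∈⇒≤maxW x (at∈ x 0 0<len))))
  ... | i , i< , xi≡1 with least-witness (λ k → at x k ≡ 1) (λ k → at x k ≟ 1) (length x)
  ... | inj₁ none = ⊥-elim (none i i< xi≡1)
  ... | inj₂ (k , k< , xk≡1 , first) with first⇒ascent k k< (λ k′ k′< e → first k′ k′< (trans e xk≡1))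
  ...   | inj₁ refl = xk≡1
  ...   | inj₂ (j , j+1≡k , rise) =
    ⊥-elim (1+n≰n (≤-trans (positive j (<-trans (subst (j <_) j+1≡k (n<1+n j)) k<)) (≤-pred (subst (at x j <_) xk≡1 rise))))

  -- A letter that is neither 1, nor a repeat, nor a first occurrence ascending from its predecessor x_j
  -- has an earlier copy x_k with 0 < k < j and x_j > x_k, giving the occurrence x_0 x_k x_j x_{j+1} of 1232.
  localStep : LocalStep x
  localStep j t< with least-witness (λ k → at x k ≡ at x (suc j)) (λ k → at x k ≟ at x (suc j)) (suc j)
  ... | inj₁ none with first⇒ascent (suc j) t< none
  ...   | inj₂ (j′ , j′+1≡t , rise) = inj₂ (inj₂ (subst (λ i → at x i < at x (suc j)) (suc-injective j′+1≡t) rise , none))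
  localStep j t< | inj₂ (k , k< , xk≡xt , _) with at x (suc j) ≟ 1
  ... | yes xt≡1 = inj₁ xt≡1
  ... | no xt≢1 with at x (suc j) ≟ at x j
  ...   | yes xt≡xj = inj₂ (inj₁ xt≡xj)
  ...   | no xt≢xj with at x j <? at x (suc j)
  ...     | yes rise = ⊥-elim (ascent⇒first j t< rise k k< xk≡xt)
  ...     | no ¬rise = ⊥-elim (avoids (Occurrence.contains x 0 k j (suc j) 0<k k<j (n<1+n j) t< a<b b<c (sym xk≡xt)))
    where
    x0≡1 : at x 0 ≡ 1
    x0≡1 = head≡1 (<-trans z<s t<)
    0<k : 0 < k
    0<k = n≢0⇒n>0 (λ k≡0 → xt≢1 (trans (sym xk≡xt) (trans (cong (at x) k≡0) x0≡1)))
    k<j : k < j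
    k<j with m≤n⇒m<n∨m≡n (≤-pred k<)
    ... | inj₁ k<j  = k<j
    ... | inj₂ refl = ⊥-elim (xt≢xj (sym xk≡xt))
    a<b : at x 0 < at x k
    a<b = subst (_< at x k) (sym x0≡1) (subst (1 <_) (sym xk≡xt) (≤∧≢⇒< (positive (suc j) t<) (xt≢1 ∘ sym)))
    b<c : at x k < at x j
    b<c = subst (_< at x j) (sym xk≡xt) (≤∧≢⇒< (≮⇒≥ ¬rise) xt≢xj)

modasc⇒Tail : ∀ x → IsModAsc x → Avoids x p1232 → x ≡ [] ⊎ Σ Word (λ xs → x ≡ 1 ∷ xs × Σ ℕ λ m → Tail m xs)
modasc⇒Tail []       _                       _       = inj₁ refl
modasc⇒Tail (y ∷ ys) (cayley , ascent⇔leftmost) avoids with head≡1 cayley ascent⇔leftmost avoids z<s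
... | refl = inj₂ (ys , refl , maxW (1 ∷ ys) ,
  mkTail (m≤m⊔n 1 (maxW ys)) (LocalStep⇒RiseOrReset 1 ys step) (proj₂ (BlockAt⇒Contiguous (1 ∷ ys) (LocalStep⇒BlockAt (1 ∷ ys) step)))
         (λ v v∈ → ∈⇒≤maxW (1 ∷ ys) (there v∈)) (proj₂ cayley))
  where
  step = localStep cayley ascent⇔leftmost avoids

modascs : ℕ → List Word
modascs zero    = [] ∷ []
modascs (suc n) = map (1 ∷_) (concatMap (λ a → tails a (n ∸ a)) (upTo (suc n)))

modascs-unique : ∀ n → Unique (modascs n)
modascs-unique zero    = All.[] ∷ []
modascs-unique (suc n) = UP.map⁺ ∷-injectiveʳ
  (Unique-concatMap (λ a → tails a (n ∸ a)) ones (upTo (suc n)) (UP.upTo⁺ (suc n))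
    (λ a _ → tails-unique a (n ∸ a)) (λ a x _ x∈ → proj₁ (proj₂ (∈-tails⇒Tail a (n ∸ a) x x∈))))

length-modascs : ∀ n → length (modascs n) ≡ count n
length-modascs zero    = refl
length-modascs (suc n) = begin
  length (map (1 ∷_) (concatMap (λ a → tails a (n ∸ a)) (upTo (suc n))))
    ≡⟨ length-map (1 ∷_) (concatMap (λ a → tails a (n ∸ a)) (upTo (suc n))) ⟩
  length (concatMap (λ a → tails a (n ∸ a)) (upTo (suc n)))
    ≡⟨ length-concatMap (λ a → tails a (n ∸ a)) (upTo (suc n)) ⟩
  sum (map (λ a → length (tails a (n ∸ a))) (upTo (suc n)))
    ≡⟨ cong sum (map-upTo (λ a → length (tails a (n ∸ a))) (suc n)) ⟩
  Σ< (suc n) (λ a → length (tails a (n ∸ a)))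
    ≡⟨ Σ<-cong (suc n) (λ a _ → length-tails a (n ∸ a)) ⟩
  count (suc n) ∎

∈-modascs⇒Modasc : ∀ n {x} → x ∈ modascs n → Modasc n p1232 x
∈-modascs⇒Modasc zero    (here refl) =
  refl , (((λ _ ()) , λ j 1≤j j≤0 → ⊥-elim (1+n≰n (≤-trans 1≤j j≤0))) , λ ()) , λ { (f , _) → ¬Fin0 (f F.zero) }
∈-modascs⇒Modasc (suc n) x∈ with ∈-map⁻ (1 ∷_) x∈
... | xs , xs∈ , refl with find (∈-concatMap⁻ (λ a → tails a (n ∸ a)) xs∈)
... | a , a∈ , xs∈tails with ∈-tails⇒Tail a (n ∸ a) xs xs∈tails
... | (m , gd) , ones≡a , others≡ = cong suc length≡n , Tail⇒modasc gd
  where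
  length≡n : length xs ≡ n
  length≡n = trans (length≡ones+others xs) (trans (cong₂ _+_ ones≡a others≡) (m+[n∸m]≡n (≤-pred (∈-upTo⁻ a∈))))

Modasc⇒∈-modascs : ∀ n {x} → Modasc n p1232 x → x ∈ modascs n
Modasc⇒∈-modascs zero    {[]}    _               = here refl
Modasc⇒∈-modascs (suc n) {x}     (len , ma , av) with modasc⇒Tail x ma av
... | inj₁ refl                  = ⊥-elim (0≢1+n len)
... | inj₂ (xs , refl , m , gd) = ∈-map⁺ (1 ∷_) (∈-concatMap⁺ (λ a → tails a (n ∸ a)) (lose (∈-upTo⁺ ones<) xs∈))
  where
  length≡n : ones xs + others xs ≡ n
  length≡n = trans (sym (length≡ones+others xs)) (suc-injective len)
  ones< : ones xs < suc n
  ones< = s≤s (subst (ones xs ≤_) length≡n (m≤m+n (ones xs) (others xs)))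
  others≡ : others xs ≡ n ∸ ones xs
  others≡ = trans (sym (m+n∸m≡n (ones xs) (others xs))) (cong (_∸ ones xs) length≡n)
  xs∈ : xs ∈ tails (ones xs) (n ∸ ones xs)
  xs∈ = subst (λ r → xs ∈ tails (ones xs) r) others≡ (Tail⇒∈-tails (others xs) m xs gd refl)

Modasc-card : ∀ n → HasCard (Modasc n p1232) (count n)
Modasc-card n = modascs n , modascs-unique n , (λ x → mk⇔ (∈-modascs⇒Modasc n) (Modasc⇒∈-modascs n)) , length-modascs n

open import Data.Integer using (+_)

proposition5p2 : ((n : ℕ) → 1 ≤ n → HasCard (Modasc n (1 ∷ 2 ∷ 3 ∷ 2 ∷ [])) (formula n))
    × ((n : ℕ) → Σ ℕ λ m → HasCard (Modasc n (1 ∷ 2 ∷ 3 ∷ 2 ∷ [])) m × + m ≡ gfSum n)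
proposition5p2 = closed-form , λ n → count n , Modasc-card n , count≡gfSum n
  where
  closed-form : (n : ℕ) → 1 ≤ n → HasCard (Modasc n p1232) (formula n)
  closed-form (suc n) _ = subst (HasCard (Modasc (suc n) p1232)) (sym (formula≡count n)) (Modasc-card (suc n))
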